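{- Let $R$ be an rc-graph in which no two strands with nonpositive labels cross, and let $1\le k\le n$. Then no two strands with nonpositive labels cross in $R\leftarrow k$.
   Context: Fix a positive integer $n$. Cells $(i,k)$ are pairs of integers with $i\le n$, $k\le n$; $(i,k)$ lies in row $k$ and column $i$, rows with larger $k$ drawn higher (row $n$ on top), columns with larger $i$ drawn further left (column $n$ leftmost). Given a finite set $R$ of cells, choose an integer $D$ with $D<i+k$ for all $(i,k)\in R$ and consider the staircase of cells $(i,k)$ with $i,k\le n$, $i+k>D$, plus diagonal half-cells with $i+k=D$. A cell $(i,k)\in R$ contains a crossing of two strands; every other non-diagonal cell contains two non-crossing elbows, one joining its left edge to its top edge and one joining its bottom edge to its right edge; a diagonal half-cell contains only an elbow joining its left edge to its top edge. For each row $k$ with $D-n\le k\le n$ a strand enters the left edge of cell $(n,k)$ and is labeled $k$ (the strands of rows $<D-n$ are considered fixed). $R$ is an rc-graph if no two strands cross more than once. Strand labels through a given cell do not depend on $D$. Insertion: a cell $(i,k)\notin R$ (non-diagonal) is an open space if the strand through its left-to-top elbow has a positive label and the strand through its bottom-to-right elbow has a nonpositive label. To insert $x\in\{1,\dots,n\}$ into $R$: set $k_1=x$, let $i_1$ be the smallest $i$ with $(i,k_1)$ open, and add $(i_1,k_1)$. Inductively, after adding $(i_j,k_j)$: if the current set is an rc-graph, stop; otherwise the two strands crossing at $(i_j,k_j)$ cross at another cell $(\ell_{j+1},k_{j+1})$ with $k_{j+1}>k_j$; remove that cell, let $i_{j+1}$ be the smallest $i>\ell_{j+1}$ with $(i,k_{j+1})$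 open, add $(i_{j+1},k_{j+1})$, and continue. This terminates in an rc-graph denoted $R\leftarrow x$. -}

module Defs where

open import Data.Nat using (ℕ; zero; suc)
open import Data.Integer using (ℤ; +_; _+_; _-_; _≤_; _<_; _⊓_; _≟_; ∣_∣; 0ℤ; 1ℤ)
open import Data.Product using (_×_; _,_; proj₁; proj₂; ∃)
open import Data.Product.Properties using (≡-dec)
open import Data.Sum using (_⊎_)
open import Data.List using (List; []; _∷_; foldr; filter)
open import Data.List.Membership.Propositional using (_∈_; _∉_)
open import Relation.Binary.PropositionalEquality using (_≡_; _≢_)
open import Relation.Binary.Definitions using (DecidableEquality)
open import Relation.Nullary using (¬_; yes; no; ¬?)
open import Relation.Nullary.Decidable using (⌊_⌋)

Cell : Set
Cell = ℤ × ℤ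

col row : Cell → ℤ
col = proj₁
row = proj₂

_≟C_ : DecidableEquality Cell
_≟C_ = ≡-dec _≟_ _≟_

open import Data.List.Membership.DecPropositional _≟C_ using (_∈?_)

InRange : ℕ → Cell → Set
InRange n (i , k) = (i ≤ + n) × (k ≤ + n)

-- finite sets of cells are represented by lists (membership is what counts)
CellSet : Set
CellSet = List Cell

remove : Cell → CellSet → CellSet
remove c S = filter (λ d → ¬? (d ≟C c)) S

-- For a set S and a cell c we choose
--   D = min { i + k | (i , k) ∈ S ∪ {c} } - 1,
-- which satisfies D < i + k for all cells of S and for c itself, so c is
-- a full (non-diagonal) cell of the staircase.  (Labels do not depend
-- on the choice of D.)

minSum : CellSet → ℤ → ℤ
minSum S m = foldr (λ d r → (col d + row d) ⊓ r) m S

chooseD : CellSet → Cell → ℤ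
chooseD S (i , k) = minSum S (i + k) - 1ℤ

-- Strand labels, computed by following strands backwards.
--   lftL f i k : label of the strand entering the LEFT edge of cell (i,k)
--   botL f i k : label of the strand entering the BOTTOM edge of (i,k)
-- A crossing cell sends left→right and bottom→top; an elbow cell sends
-- left→top and bottom→right; a diagonal half cell (i+k = D) sends
-- left→top.  The strand entering the left edge of (n,k) is labelled k.
-- f is fuel; the amount  ∣ k - i - D + 2n ∣  used below always suffices
-- (each step lowers k - i by one, and k - i ≥ D - 2n with equality only
-- at (n , D - n), where lftL returns without recursion).

module Labels (n : ℕ) (S : CellSet) (D : ℤ) where
  mutual
    lftL : ℕ → ℤ → ℤ → ℤ
    lftL f i k with i ≟ + n
    ... | yes _ = k
    lftL zero i k | no _ = 0ℤ
    lftL (suc f) i k | no _ with (i + 1ℤ , k) ∈? S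
    ... | yes _ = lftL f (i + 1ℤ) k
    ... | no _  = botL f (i + 1ℤ) k

    botL : ℕ → ℤ → ℤ → ℤ
    botL zero i k = 0ℤ
    botL (suc f) i k with (i + (k - 1ℤ)) ≟ D
    ... | yes _ = lftL f i (k - 1ℤ)
    ... | no _ with (i , k - 1ℤ) ∈? S
    ... | yes _ = botL f i (k - 1ℤ)
    ... | no _  = lftL f i (k - 1ℤ)

fuel : ℕ → ℤ → Cell → ℕ
fuel n D (i , k) = ∣ k - i - D + (+ n + + n) ∣

leftLabel : ℕ → CellSet → Cell → ℤ
leftLabel n S c = Labels.lftL n S D (fuel n D c) (col c) (row c)
  where D = chooseD S c

bottomLabel : ℕ → CellSet → Cell → ℤ
bottomLabel n S c = Labels.botL n S D (fuel n D c) (col c) (row c)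
  where D = chooseD S c

-- Crossings and rc-graphs.  At a crossing cell c ∈ S the two strands
-- crossing are those entering its left and bottom edges.

SamePair : ℕ → CellSet → Cell → Cell → Set
SamePair n S c c' =
  (leftLabel n S c ≡ leftLabel n S c' × bottomLabel n S c ≡ bottomLabel n S c')
  ⊎ (leftLabel n S c ≡ bottomLabel n S c' × bottomLabel n S c ≡ leftLabel n S c')

IsRC : ℕ → CellSet → Set
IsRC n S = ∀ c c' → c ∈ S → c' ∈ S → c ≢ c' → ¬ SamePair n S c c'

NoNonposCross : ℕ → CellSet → Set
NoNonposCross n S =
  ∀ c → c ∈ S → ¬ ((leftLabel n S c ≤ 0ℤ) × (bottomLabel n S c ≤ 0ℤ))

IsOpen : ℕ → CellSet → Cell → Set
IsOpen n S c =
  InRange n c × c ∉ S × (0ℤ < leftLabel n S c) × (bottomLabel n S c ≤ 0ℤ)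

IsLeastOpen : ℕ → CellSet → ℤ → (ℤ → Set) → ℤ → Set
IsLeastOpen n S k P i =
  P i × IsOpen n S (i , k) × (∀ j → P j → IsOpen n S (j , k) → i ≤ j)

-- Run n S c R' : running the insertion loop from the current set S, whose
-- most recently added cell is c, terminates with the rc-graph R'.
data Run (n : ℕ) : CellSet → Cell → CellSet → Set where
  stop : ∀ {S c} → IsRC n S → Run n S c S
  bump : ∀ {S c R'} → ¬ IsRC n S →
         (c' : Cell) → c' ∈ S → c' ≢ c → SamePair n S c c' → row c < row c' →
         (i : ℤ) → IsLeastOpen n (remove c' S) (row c') (λ j → col c' < j) i →
         Run n ((i , row c') ∷ remove c' S) (i , row c') R' →
         Run n S c R'

Insert : ℕ → CellSet → ℤ → CellSet → Set
Insert n R x R' =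
  ∃ λ i → IsLeastOpen n R x (λ _ → ℤ) i × Run n ((i , x) ∷ R) (i , x) R'

{-# OPTIONS --safe #-}
module Submission where

-- Read the rc-graph as a wiring diagram: the crossing in cell (i , k) exchanges, at time k - i,
-- the strands at positions i + k and i + k + 1, and the labels of Defs are recovered by running
-- these transpositions forward in time. Adding to an rc-graph T a crossing at time t₀ of the
-- strands a > 0 (from the left) and b ≤ 0 (from below) leaves all labels before t₀ unchanged and
-- exchanges a and b after t₀. Hence a crossing of two nonpositive strands after t₀ comes from a
-- crossing of a with some x ≤ 0 in T; comparing the order of x, b and a at time t₀ with their
-- initial order (b and x never cross, a and x cross only once) shows that a and b cross in T
-- after t₀. In the new diagram that is a second crossing of a and b: if the diagram is an
-- rc-graph this is absurd, and otherwise it is exactly the crossing the insertion removes next.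
-- Removing it exchanges a and b back on an interval at whose ends a and b are adjacent, and no
-- strand can cross just one of two such strands inside it, so the result is again an rc-graph
-- without nonpositive crossings.

open import Defs
open import Data.Nat using (ℕ)
open import Data.Integer using (ℤ; +_; _≤_)
open import Data.List.Relation.Unary.All using (All)

open import Data.Nat using (zero; suc)
import Data.Nat.Properties as ℕP
open import Data.Integer using (_+_; _-_; -_; _<_; _⊓_; 0ℤ; 1ℤ; -1ℤ; ∣_∣; -[1+_]; -≤+; _≟_; _≤?_; _<?_)
import Data.Integer.Properties as ZP
open import Data.Integer.Tactic.RingSolver using (solve-∀)
open import Data.Product using (_×_; _,_; proj₁; proj₂; ∃)
open import Data.Sum using (_⊎_; inj₁; inj₂)
open import Data.Empty using (⊥; ⊥-elim)
open import Data.List using ([]; _∷_; foldr)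
open import Data.List.Relation.Unary.Any using (Any; any?; here; there)
import Data.List.Relation.Unary.All as All
open import Data.List.Membership.Propositional using (_∈_; _∉_; find; lose)
open import Data.List.Membership.Propositional.Properties using (∈-filter⁺; ∈-filter⁻)
open import Data.List.Membership.DecPropositional _≟C_ using (_∈?_)
open import Function using (id; _∘_)
open import Relation.Binary.Definitions using (tri<; tri≈; tri>)
open import Relation.Binary.PropositionalEquality
  using (_≡_; _≢_; refl; sym; trans; cong; cong₂; subst; subst₂; module ≡-Reasoning)
open import Relation.Nullary using (¬_; Dec; yes; no; contradiction)
open import Relation.Nullary.Decidable using (_×-dec_; ¬?; map′)

private
  variable
    p p₁ p₂ q r s t t₁ t₂ u v w x y z : ℤ
    f : ℕ
    S T : CellSet
    d e : Cell

i<i+1 : ∀ i → i < i + 1ℤ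
i<i+1 i = subst (i <_) (ZP.+-comm 1ℤ i) (ZP.suc[i]≤j⇒i<j ZP.≤-refl)

i-1<i : ∀ i → i - 1ℤ < i
i-1<i i = ZP.i≤pred[j]⇒i<j (ZP.≤-reflexive (ZP.+-comm i -1ℤ))

<⇒+1≤ : x < y → x + 1ℤ ≤ y
<⇒+1≤ {x} h = subst (_≤ _) (ZP.+-comm 1ℤ x) (ZP.i<j⇒suc[i]≤j h)

<⇒≤-1 : x < y → x ≤ y - 1ℤ
<⇒≤-1 {y = y} h = subst (_ ≤_) (ZP.+-comm -1ℤ y) (ZP.i<j⇒i≤pred[j] h)

≤+suc⇒-1≤ : ∀ {m} → x ≤ + suc m → x - 1ℤ ≤ + m
≤+suc⇒-1≤ = ZP.+-monoˡ-≤ -1ℤ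

<⇒0<- : x < y → 0ℤ < y - x
<⇒0<- {x} {y} x<y = subst (_< y - x) (ZP.+-inverseʳ x) (ZP.+-monoˡ-< (- x) x<y)

i≤+∣i∣ : ∀ i → i ≤ + ∣ i ∣
i≤+∣i∣ (+ _)    = ZP.≤-refl
i≤+∣i∣ -[1+ _ ] = -≤+

i-1+1≡i : ∀ i → i - 1ℤ + 1ℤ ≡ i
i-1+1≡i i = trans (ZP.+-assoc i -1ℤ 1ℤ) (ZP.+-identityʳ i)

i+1-1≡i : ∀ i → i + 1ℤ - 1ℤ ≡ i
i+1-1≡i i = trans (ZP.+-assoc i 1ℤ -1ℤ) (ZP.+-identityʳ i)

+1-injective : x + 1ℤ ≡ y + 1ℤ → x ≡ y
+1-injective {x} {y} e = trans (sym (i+1-1≡i x)) (trans (cong (_- 1ℤ) e) (i+1-1≡i y))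

double-injective : x + x ≡ y + y → x ≡ y
double-injective {x} {y} e with ZP.<-cmp x y
... | tri< x<y _ _ = contradiction e (ZP.<⇒≢ (ZP.+-mono-< x<y x<y))
... | tri≈ _ x≡y _ = x≡y
... | tri> _ _ y<x = contradiction (sym e) (ZP.<⇒≢ (ZP.+-mono-< y<x y<x))

double≢double+1 : ∀ x y → x + x ≢ y + y + 1ℤ
double≢double+1 x y e with x ≤? y
... | yes x≤y = ZP.<-irrefl e (ZP.≤-<-trans (ZP.+-mono-≤ x≤y x≤y) (i<i+1 (y + y)))
... | no x≰y = ZP.<-irrefl (sym e)
                 (ZP.≤-<-trans (<⇒+1≤ (ZP.+-monoʳ-< y y<x)) (ZP.+-monoˡ-< x y<x))
  where y<x = ZP.≰⇒> x≰y

≥-induction : (P : ℤ → Set) → P x → (∀ t → x ≤ t → P t → P (t + 1ℤ)) → ∀ t → x ≤ t → P t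
≥-induction {x} P base step t x≤t = subst P x+∣t-x∣≡t (go ∣ t - x ∣)
  where
    go : ∀ m → P (x + + m)
    go zero    = subst P (sym (ZP.+-identityʳ x)) base
    go (suc m) = subst P (trans (ZP.+-assoc x (+ m) 1ℤ) (cong (λ j → x + + j) (ℕP.+-comm m 1)))
                   (step (x + + m) (ZP.i≤i+j x (+ m)) (go m))
    x+∣t-x∣≡t : x + + ∣ t - x ∣ ≡ t
    x+∣t-x∣≡t = trans (cong (_+_ x) (ZP.0≤i⇒+∣i∣≡i (ZP.i≤j⇒0≤j-i x≤t))) (x+[t-x]≡t x t)
      where
        x+[t-x]≡t : ∀ x t → x + (t - x) ≡ t
        x+[t-x]≡t = solve-∀

induction-above : (P : ℤ → Set) (b : ℤ) → (∀ t → t ≤ b → P t) →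
                  (∀ t → b ≤ t → P t → P (t + 1ℤ)) → ∀ t → P t
induction-above P b base step t with t ≤? b
... | yes t≤b = base t t≤b
... | no t≰b  = ≥-induction P (base b ZP.≤-refl) step t (ZP.<⇒≤ (ZP.≰⇒> t≰b))

module _ {A : Set} (f : A → ℤ) where
  foldr-⊓-≤-init : ∀ m xs → foldr (λ x r → f x ⊓ r) m xs ≤ m
  foldr-⊓-≤-init m []       = ZP.≤-refl
  foldr-⊓-≤-init m (_ ∷ xs) = ZP.≤-trans (ZP.i⊓j≤j _ _) (foldr-⊓-≤-init m xs)

  foldr-⊓-≤-member : ∀ m {x} xs → x ∈ xs → foldr (λ x r → f x ⊓ r) m xs ≤ f x
  foldr-⊓-≤-member m (_ ∷ _)  (here refl)  = ZP.i⊓j≤i _ _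
  foldr-⊓-≤-member m (_ ∷ xs) (there x∈xs) = ZP.≤-trans (ZP.i⊓j≤j _ _) (foldr-⊓-≤-member m xs x∈xs)

-- Crossings as adjacent transpositions

-- The crossing in cell (i , k) happens at time k - i and exchanges the strands at
-- positions i + k (its bottom edge) and i + k + 1 (its left edge).
time pos : Cell → ℤ
time d = row d - col d
pos d = col d + row d

record IsAt (t q : ℤ) (d : Cell) : Set where
  constructor at
  field
    time≡ : time d ≡ t
    pos≡  : pos d ≡ q

pos-time : ∀ i k → (i + k) - (k - i) ≡ i + i
pos-time = solve-∀

private
  time+pos : ∀ i k → (k - i) + (i + k) ≡ k + k
  time+pos = solve-∀

at-unique : IsAt t q d → IsAt t q e → d ≡ e
at-unique {d = i , k} {e = i′ , k′} (at refl refl) (at t≡ q≡) = cong₂ _,_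
  (double-injective (trans (sym (pos-time i k)) (trans (cong₂ _-_ (sym q≡) (sym t≡)) (pos-time i′ k′))))
  (double-injective (trans (sym (time+pos i k)) (trans (cong₂ _+_ (sym t≡) (sym q≡)) (time+pos i′ k′))))

at-parity : IsAt t q d → ¬ IsAt t (q + 1ℤ) e
at-parity {d = i , k} {e = i′ , k′} (at refl refl) (at t≡ q≡) = double≢double+1 i′ i (begin
  i′ + i′                   ≡⟨ pos-time i′ k′ ⟨
  (i′ + k′) - (k′ - i′)     ≡⟨ cong₂ _-_ q≡ t≡ ⟩
  (i + k + 1ℤ) - (k - i)    ≡⟨ shift (i + k) (k - i) ⟩
  (i + k) - (k - i) + 1ℤ    ≡⟨ cong (_+ 1ℤ) (pos-time i k) ⟩
  i + i + 1ℤ                ∎)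
  where
    open ≡-Reasoning
    shift : ∀ q t → (q + 1ℤ) - t ≡ (q - t) + 1ℤ
    shift = solve-∀

Crossing : CellSet → ℤ → ℤ → Set
Crossing S t q = Any (IsAt t q) S

crossing? : ∀ S t q → Dec (Crossing S t q)
crossing? S t q = any? (λ d → map′ (λ (e₁ , e₂) → at e₁ e₂) (λ (at e₁ e₂) → e₁ , e₂)
                                    ((time d ≟ t) ×-dec (pos d ≟ q))) S

no-adjacent-crossings : Crossing S t q → ¬ Crossing S t (q + 1ℤ)
no-adjacent-crossings c c′ with find c | find c′
... | _ , _ , d-at | _ , _ , e-at = at-parity d-at e-at

∉⇒¬crossing : d ∉ S → IsAt t q d → ¬ Crossing S t q
∉⇒¬crossing d∉S d-at c with find c
... | _ , e∈S , e-at with at-unique e-at d-at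
... | refl = d∉S e∈S

swapAt : CellSet → ℤ → ℤ → ℤ
swapAt S t p with crossing? S t p | crossing? S t (p - 1ℤ)
... | yes _ | _     = p + 1ℤ
... | no _  | yes _ = p - 1ℤ
... | no _  | no _  = p

data SwapAtView (S : CellSet) (t p : ℤ) : Set where
  up    : Crossing S t p → swapAt S t p ≡ p + 1ℤ → SwapAtView S t p
  down  : Crossing S t (p - 1ℤ) → swapAt S t p ≡ p - 1ℤ → SwapAtView S t p
  fixed : ¬ Crossing S t p → ¬ Crossing S t (p - 1ℤ) → swapAt S t p ≡ p → SwapAtView S t p

swapAt-up : Crossing S t p → swapAt S t p ≡ p + 1ℤ
swapAt-up {S} {t} {p} c with crossing? S t p
... | yes _ = refl
... | no ¬c = contradiction c ¬c

swapAt-down′ : Crossing S t (p - 1ℤ) → swapAt S t p ≡ p - 1ℤ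
swapAt-down′ {S} {t} {p} c with crossing? S t p | crossing? S t (p - 1ℤ)
... | yes c′ | _     = contradiction (subst (Crossing S t) (sym (i-1+1≡i p)) c′) (no-adjacent-crossings c)
... | no _   | yes _ = refl
... | no _   | no ¬c = contradiction c ¬c

swapAt-fixed : ¬ Crossing S t p → ¬ Crossing S t (p - 1ℤ) → swapAt S t p ≡ p
swapAt-fixed {S} {t} {p} ¬c ¬c′ with crossing? S t p | crossing? S t (p - 1ℤ)
... | yes c | _     = contradiction c ¬c
... | no _  | yes c = contradiction c ¬c′
... | no _  | no _  = refl

swapAt-view : ∀ S t p → SwapAtView S t p
swapAt-view S t p with crossing? S t p | crossing? S t (p - 1ℤ)
... | yes c  | _      = up c (swapAt-up c)
... | no ¬c  | yes c  = down c (swapAt-down′ c)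
... | no ¬c  | no ¬c′ = fixed ¬c ¬c′ (swapAt-fixed ¬c ¬c′)

swapAt-down : Crossing S t p → swapAt S t (p + 1ℤ) ≡ p
swapAt-down {S} {t} {p} c =
  trans (swapAt-down′ (subst (Crossing S t) (sym (i+1-1≡i p)) c)) (i+1-1≡i p)

swapAt-involutive : ∀ S t p → swapAt S t (swapAt S t p) ≡ p
swapAt-involutive S t p with swapAt-view S t p
... | up c e      = trans (cong (swapAt S t) e) (swapAt-down c)
... | down c e    = trans (cong (swapAt S t) e) (trans (swapAt-up c) (i-1+1≡i p))
... | fixed _ _ e = trans (cong (swapAt S t) e) e

swapAt-injective : ∀ S t → swapAt S t x ≡ swapAt S t y → x ≡ y
swapAt-injective {x} {y} S t e =
  trans (sym (swapAt-involutive S t x)) (trans (cong (swapAt S t) e) (swapAt-involutive S t y))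

swapAt-≤ : ∀ S t p → swapAt S t p ≤ p + 1ℤ
swapAt-≤ S t p with swapAt-view S t p
... | up _ e      = ZP.≤-reflexive e
... | down _ e    = subst (_≤ p + 1ℤ) (sym e) (ZP.<⇒≤ (ZP.<-trans (i-1<i p) (i<i+1 p)))
... | fixed _ _ e = subst (_≤ p + 1ℤ) (sym e) (ZP.<⇒≤ (i<i+1 p))

¬crossing⇒swapAt-≤ : ∀ S t p → ¬ Crossing S t p → swapAt S t p ≤ p
¬crossing⇒swapAt-≤ S t p ¬c with swapAt-view S t p
... | up c _      = contradiction c ¬c
... | down _ e    = subst (_≤ p) (sym e) (ZP.<⇒≤ (i-1<i p))
... | fixed _ _ e = ZP.≤-reflexive e

swapAt-≥ : ∀ S t p → p - 1ℤ ≤ swapAt S t p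
swapAt-≥ S t p with swapAt-view S t p
... | up _ e      = subst (p - 1ℤ ≤_) (sym e) (ZP.<⇒≤ (ZP.<-trans (i-1<i p) (i<i+1 p)))
... | down _ e    = ZP.≤-reflexive (sym e)
... | fixed _ _ e = subst (p - 1ℤ ≤_) (sym e) (ZP.<⇒≤ (i-1<i p))

swapAt-monotone : ∀ S t → x < y → swapAt S t x < swapAt S t y ⊎ (y ≡ x + 1ℤ × Crossing S t x)
swapAt-monotone {x} {y} S t x<y = by-cases (crossing? S t x) (y ≟ x + 1ℤ)
  where
    strict : swapAt S t x ≤ y - 1ℤ → swapAt S t x < swapAt S t y
    strict h = ZP.≤∧≢⇒< (ZP.≤-trans h (swapAt-≥ S t y)) (λ e → ZP.<⇒≢ x<y (swapAt-injective {x} {y} S t e))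

    by-cases : Dec (Crossing S t x) → Dec (y ≡ x + 1ℤ) →
               swapAt S t x < swapAt S t y ⊎ (y ≡ x + 1ℤ × Crossing S t x)
    by-cases (yes c) (yes y≡x+1) = inj₂ (y≡x+1 , c)
    by-cases (yes _) (no y≢x+1)  = inj₁ (strict (ZP.≤-trans (swapAt-≤ S t x) (<⇒≤-1 x+1<y)))
      where x+1<y = ZP.≤∧≢⇒< (<⇒+1≤ x<y) (λ e → y≢x+1 (sym e))
    by-cases (no ¬c) _           = inj₁ (strict (ZP.≤-trans (¬crossing⇒swapAt-≤ S t x ¬c) (<⇒≤-1 x<y)))

swapAt-local : ∀ {S T} → (Crossing S t p → Crossing T t p) → (Crossing T t p → Crossing S t p) →
               (Crossing S t (p - 1ℤ) → Crossing T t (p - 1ℤ)) → (Crossing T t (p - 1ℤ) → Crossing S t (p - 1ℤ)) →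
               swapAt S t p ≡ swapAt T t p
swapAt-local {t} {p} {S} {T} S⇒T T⇒S S⇒T′ T⇒S′ with swapAt-view T t p
... | up c e        = trans (swapAt-up (T⇒S c)) (sym e)
... | down c e      = trans (swapAt-down′ (T⇒S′ c)) (sym e)
... | fixed ¬c ¬c′ e = trans (swapAt-fixed (λ c → ¬c (S⇒T c)) (λ c → ¬c′ (S⇒T′ c))) (sym e)

no-crossing-beside : IsAt t q d → ¬ Crossing S t (q + 1ℤ) × ¬ Crossing S t (q - 1ℤ)
no-crossing-beside {q = q} d-at =
  (λ c → let _ , _ , e-at = find c in at-parity d-at e-at) ,
  (λ c → let _ , _ , e-at = find c in at-parity e-at (subst (λ r → IsAt _ r _) (sym (i-1+1≡i q)) d-at))

swapAt-vacant : IsAt t q d → ¬ Crossing S t q → swapAt S t q ≡ q × swapAt S t (q + 1ℤ) ≡ q + 1ℤ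
swapAt-vacant {t} {q} {S = S} d-at ¬c =
  swapAt-fixed ¬c (proj₂ (no-crossing-beside d-at)) ,
  swapAt-fixed (proj₁ (no-crossing-beside d-at)) (λ c → ¬c (subst (Crossing S t) (i+1-1≡i q) c))

-- Strand labels

module Labelling (n : ℕ) (B : ℤ) where
  -- Before the first crossing the strand at position p is the one entering
  -- the left edge of cell (n , p - n - 1).
  initialLabel initialPosition : ℤ → ℤ
  initialLabel p = p - + n - 1ℤ
  initialPosition u = u + + n + 1ℤ

  After : CellSet → Set
  After S = ∀ {t q} → Crossing S t q → B ≤ t

  labelWithin positionWithin : CellSet → ℕ → ℤ → ℤ → ℤ
  labelWithin S zero    t p = initialLabel p
  labelWithin S (suc f) t p = labelWithin S f (t - 1ℤ) (swapAt S (t - 1ℤ) p)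
  positionWithin S zero    t u = initialPosition u
  positionWithin S (suc f) t u = swapAt S (t - 1ℤ) (positionWithin S f (t - 1ℤ) u)

  -- label S t p is the label of the strand at position p just before the crossings of time t,
  -- found by undoing the crossings since time B; position S t is its inverse.
  label position : CellSet → ℤ → ℤ → ℤ
  label S t = labelWithin S ∣ t - B ∣ t
  position S t = positionWithin S ∣ t - B ∣ t

  private
    fuel-exhausted : ∀ t → t - B ≤ + 0 → t ≤ B
    fuel-exhausted _ = ZP.i-j≤0⇒i≤j

    fuel-pred : ∀ t → t - B ≤ + suc f → t - 1ℤ - B ≤ + f
    fuel-pred t h = subst (_≤ _) (shift t B) (≤+suc⇒-1≤ h)
      where
        shift : ∀ t B → t - B - 1ℤ ≡ t - 1ℤ - B
        shift = solve-∀

    fuel-suc : ∀ t → t + 1ℤ - B ≤ + suc ∣ t - B ∣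
    fuel-suc t = subst₂ _≤_ (shift t B) (ZP.+-comm (+ ∣ t - B ∣) 1ℤ) (ZP.+-monoˡ-≤ 1ℤ (i≤+∣i∣ (t - B)))
      where
        shift : ∀ t B → t - B + 1ℤ ≡ t + 1ℤ - B
        shift = solve-∀

  module _ {S : CellSet} (A : After S) where
    swapAt-before : t < B → swapAt S t p ≡ p
    swapAt-before t<B = swapAt-fixed (λ c → ZP.<⇒≱ t<B (A c)) (λ c → ZP.<⇒≱ t<B (A c))

    labelWithin-before : ∀ f t p → t ≤ B → labelWithin S f t p ≡ initialLabel p
    labelWithin-before zero    _ _ _   = refl
    labelWithin-before (suc f) t p t≤B =
      trans (cong (labelWithin S f (t - 1ℤ)) (swapAt-before t-1<B)) (labelWithin-before f _ _ (ZP.<⇒≤ t-1<B))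
      where t-1<B = ZP.<-≤-trans (i-1<i t) t≤B

    positionWithin-before : ∀ f t u → t ≤ B → positionWithin S f t u ≡ initialPosition u
    positionWithin-before zero    _ _ _   = refl
    positionWithin-before (suc f) t u t≤B =
      trans (cong (swapAt S (t - 1ℤ)) (positionWithin-before f _ _ (ZP.<⇒≤ t-1<B))) (swapAt-before t-1<B)
      where t-1<B = ZP.<-≤-trans (i-1<i t) t≤B

    labelWithin-stable : ∀ f f′ t p → t - B ≤ + f → t - B ≤ + f′ → labelWithin S f t p ≡ labelWithin S f′ t p
    labelWithin-stable zero    f′       t p h h′ = sym (labelWithin-before f′ t p (fuel-exhausted t h))
    labelWithin-stable (suc f) zero     t p h h′ = labelWithin-before (suc f) t p (fuel-exhausted t h′)
    labelWithin-stable (suc f) (suc f′) t p h h′ =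
      labelWithin-stable f f′ _ _ (fuel-pred t h) (fuel-pred t h′)

    positionWithin-stable : ∀ f f′ t u → t - B ≤ + f → t - B ≤ + f′ →
                            positionWithin S f t u ≡ positionWithin S f′ t u
    positionWithin-stable zero    f′       t u h h′ = sym (positionWithin-before f′ t u (fuel-exhausted t h))
    positionWithin-stable (suc f) zero     t u h h′ = positionWithin-before (suc f) t u (fuel-exhausted t h′)
    positionWithin-stable (suc f) (suc f′) t u h h′ =
      cong (swapAt S (t - 1ℤ)) (positionWithin-stable f f′ _ _ (fuel-pred t h) (fuel-pred t h′))

    label-before : ∀ t p → t ≤ B → label S t p ≡ initialLabel p
    label-before t = labelWithin-before ∣ t - B ∣ t

    position-before : ∀ t u → t ≤ B → position S t u ≡ initialPosition u
    position-before t = positionWithin-before ∣ t - B ∣ t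

    label-step : ∀ t p → label S (t + 1ℤ) p ≡ label S t (swapAt S t p)
    label-step t p =
      trans (labelWithin-stable _ (suc ∣ t - B ∣) (t + 1ℤ) p (i≤+∣i∣ _) (fuel-suc t))
            (cong (λ s → labelWithin S ∣ t - B ∣ s (swapAt S s p)) (i+1-1≡i t))

    position-step : ∀ t u → position S (t + 1ℤ) u ≡ swapAt S t (position S t u)
    position-step t u =
      trans (positionWithin-stable _ (suc ∣ t - B ∣) (t + 1ℤ) u (i≤+∣i∣ _) (fuel-suc t))
            (cong (λ s → swapAt S s (positionWithin S ∣ t - B ∣ s u)) (i+1-1≡i t))

    label-position : ∀ t u → label S t (position S t u) ≡ u
    label-position t u = induction-above (λ t → label S t (position S t u) ≡ u) B before step t
      where
        before : ∀ t → t ≤ B → label S t (position S t u) ≡ u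
        before t t≤B = begin
          label S t (position S t u)       ≡⟨ cong (label S t) (position-before t u t≤B) ⟩
          label S t (initialPosition u)    ≡⟨ label-before t _ t≤B ⟩
          initialLabel (initialPosition u) ≡⟨ cancel u (+ n) ⟩
          u                                ∎
          where
            open ≡-Reasoning
            cancel : ∀ u n → u + n + 1ℤ - n - 1ℤ ≡ u
            cancel = solve-∀
        step : ∀ t → B ≤ t → label S t (position S t u) ≡ u → label S (t + 1ℤ) (position S (t + 1ℤ) u) ≡ u
        step t _ ih = begin
          label S (t + 1ℤ) (position S (t + 1ℤ) u)               ≡⟨ cong (label S (t + 1ℤ)) (position-step t u) ⟩
          label S (t + 1ℤ) (swapAt S t (position S t u))         ≡⟨ label-step t _ ⟩
          label S t (swapAt S t (swapAt S t (position S t u)))   ≡⟨ cong (label S t) (swapAt-involutive S t _) ⟩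
          label S t (position S t u)                             ≡⟨ ih ⟩
          u                                                      ∎
          where open ≡-Reasoning

    position-label : ∀ t p → position S t (label S t p) ≡ p
    position-label t = induction-above (λ t → ∀ p → position S t (label S t p) ≡ p) B before step t
      where
        before : ∀ t → t ≤ B → ∀ p → position S t (label S t p) ≡ p
        before t t≤B p = begin
          position S t (label S t p)       ≡⟨ cong (position S t) (label-before t p t≤B) ⟩
          position S t (initialLabel p)    ≡⟨ position-before t _ t≤B ⟩
          initialPosition (initialLabel p) ≡⟨ cancel p (+ n) ⟩
          p                                ∎
          where
            open ≡-Reasoning
            cancel : ∀ p n → p - n - 1ℤ + n + 1ℤ ≡ p
            cancel = solve-∀
        step : ∀ t → B ≤ t → (∀ p → position S t (label S t p) ≡ p) →
               ∀ p → position S (t + 1ℤ) (label S (t + 1ℤ) p) ≡ p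
        step t _ ih p = begin
          position S (t + 1ℤ) (label S (t + 1ℤ) p)         ≡⟨ position-step t _ ⟩
          swapAt S t (position S t (label S (t + 1ℤ) p))   ≡⟨ cong (λ u → swapAt S t (position S t u)) (label-step t p) ⟩
          swapAt S t (position S t (label S t (swapAt S t p))) ≡⟨ cong (swapAt S t) (ih _) ⟩
          swapAt S t (swapAt S t p)                        ≡⟨ swapAt-involutive S t p ⟩
          p                                                ∎
          where open ≡-Reasoning

    label-injective : ∀ t → label S t x ≡ label S t y → x ≡ y
    label-injective {x} {y} t e =
      trans (sym (position-label t x)) (trans (cong (position S t) e) (position-label t y))

    position-injective : ∀ t → position S t x ≡ position S t y → x ≡ y
    position-injective {x} {y} t e =
      trans (sym (label-position t x)) (trans (cong (label S t) e) (label-position t y))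

-- Agreement with leftLabel and bottomLabel

module Bridge (n : ℕ) (B : ℤ) where
  open Labelling n B

  Bounded : CellSet → Set
  Bounded S = ∀ {t q} → Crossing S t q → q - t ≤ + n + + n

  label-high : After S → Bounded S → ∀ t p → + n + + n < p - t → label S t p ≡ initialLabel p
  label-high {S} A bd t = induction-above (λ t → ∀ p → + n + + n < p - t → label S t p ≡ initialLabel p) B
    (λ t t≤B p _ → label-before A t p t≤B) step t
    where
      step : ∀ t → B ≤ t → (∀ p → + n + + n < p - t → label S t p ≡ initialLabel p) →
             ∀ p → + n + + n < p - (t + 1ℤ) → label S (t + 1ℤ) p ≡ initialLabel p
      step t _ ih p high = trans (label-step A t p) (trans (cong (label S t) (swapAt-fixed ¬c ¬c′)) (ih p high′))
        where
          shift : ∀ p t → p - 1ℤ - t ≡ p - (t + 1ℤ)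
          shift = solve-∀
          high′ : + n + + n < p - t
          high′ = ZP.<-trans high (ZP.+-monoʳ-< p (ZP.neg-mono-< (i<i+1 t)))
          ¬c : ¬ Crossing S t p
          ¬c c = ZP.<⇒≱ high′ (bd c)
          ¬c′ : ¬ Crossing S t (p - 1ℤ)
          ¬c′ c = ZP.<⇒≱ high (subst (_≤ _) (shift p t) (bd c))

  leftEdge bottomEdge rightEdge topEdge : CellSet → Cell → ℤ
  leftEdge   S d = label S (time d) (pos d + 1ℤ)
  bottomEdge S d = label S (time d) (pos d)
  rightEdge  S d = label S (time d + 1ℤ) (pos d)
  topEdge    S d = label S (time d + 1ℤ) (pos d + 1ℤ)

  crossing-edges : After S → d ∈ S → rightEdge S d ≡ leftEdge S d × topEdge S d ≡ bottomEdge S d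
  crossing-edges {S} {d} A d∈S =
    trans (label-step A (time d) (pos d)) (cong (label S (time d)) (swapAt-up c)) ,
    trans (label-step A (time d) (pos d + 1ℤ)) (cong (label S (time d)) (swapAt-down c))
    where
      c : Crossing S (time d) (pos d)
      c = lose d∈S (at refl refl)

  elbow-edges : After S → d ∉ S → rightEdge S d ≡ bottomEdge S d × topEdge S d ≡ leftEdge S d
  elbow-edges {S} {d} A d∉S =
    trans (label-step A (time d) (pos d)) (cong (label S (time d)) (proj₁ vacant)) ,
    trans (label-step A (time d) (pos d + 1ℤ)) (cong (label S (time d)) (proj₂ vacant))
    where
      d-at : IsAt (time d) (pos d) d
      d-at = at refl refl
      vacant = swapAt-vacant d-at (∉⇒¬crossing d∉S d-at)

  rightEdge-left-neighbour : ∀ S i k → rightEdge S (i + 1ℤ , k) ≡ leftEdge S (i , k)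
  rightEdge-left-neighbour S i k = cong₂ (label S) (time≡ i k) (pos≡ i k)
    where
      time≡ : ∀ i k → k - (i + 1ℤ) + 1ℤ ≡ k - i
      time≡ = solve-∀
      pos≡ : ∀ i k → i + 1ℤ + k ≡ i + k + 1ℤ
      pos≡ = solve-∀

  topEdge-lower-neighbour : ∀ S i k → topEdge S (i , k - 1ℤ) ≡ bottomEdge S (i , k)
  topEdge-lower-neighbour S i k = cong₂ (label S) (time≡ i k) (pos≡ i k)
    where
      time≡ : ∀ i k → k - 1ℤ - i + 1ℤ ≡ k - i
      time≡ = solve-∀
      pos≡ : ∀ i k → i + (k - 1ℤ) + 1ℤ ≡ i + k
      pos≡ = solve-∀

  leftEdge-column-n : After S → Bounded S → ∀ k → leftEdge S (+ n , k) ≡ k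
  leftEdge-column-n A bd k =
    trans (label-high A bd (k - + n) (+ n + k + 1ℤ) (subst (+ n + + n <_) (sym (gap (+ n) k)) (i<i+1 _))) (relabel (+ n) k)
    where
      gap : ∀ n k → n + k + 1ℤ - (k - n) ≡ n + n + 1ℤ
      gap = solve-∀
      relabel : ∀ n k → n + k + 1ℤ - n - 1ℤ ≡ k
      relabel = solve-∀

  module _ {S : CellSet} {D : ℤ} (A : After S) (bd : Bounded S) (D<pos : ∀ {d} → d ∈ S → D < pos d) where
    open Labels n S D

    private
      measure : ℤ → ℤ → ℤ
      measure i k = k - i - D + (+ n + + n)

      measure-left : ∀ i k → measure (i + 1ℤ) k ≡ measure i k - 1ℤ
      measure-left i k = shift i k D (+ n)
        where
          shift : ∀ i k D n → k - (i + 1ℤ) - D + (n + n) ≡ k - i - D + (n + n) - 1ℤ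
          shift = solve-∀

      measure-down : ∀ i k → measure i (k - 1ℤ) ≡ measure i k - 1ℤ
      measure-down i k = shift i k D (+ n)
        where
          shift : ∀ i k D n → k - 1ℤ - i - D + (n + n) ≡ k - i - D + (n + n) - 1ℤ
          shift = solve-∀

      -- The measure is (i + k - D) + 2 (n - i), positive unless i = n and the cell is diagonal.
      measure-positive : ∀ i k → i ≤ + n → D ≤ i + k → i < + n ⊎ D < i + k → 0ℤ < measure i k
      measure-positive i k i≤n D≤i+k strict = subst (0ℤ <_) (sym (split i k D (+ n))) (positive strict)
        where
          split : ∀ i k D n → k - i - D + (n + n) ≡ (i + k - D) + ((n - i) + (n - i))
          split = solve-∀
          positive : i < + n ⊎ D < i + k → 0ℤ < (i + k - D) + ((+ n - i) + (+ n - i))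
          positive (inj₁ i<n) = ZP.+-mono-≤-< (ZP.i≤j⇒0≤j-i D≤i+k) (ZP.+-mono-< 0<n-i 0<n-i)
            where 0<n-i = <⇒0<- i<n
          positive (inj₂ D<i+k) = ZP.+-mono-<-≤ (<⇒0<- D<i+k) (ZP.+-mono-≤ 0≤n-i 0≤n-i)
            where 0≤n-i = ZP.i≤j⇒0≤j-i i≤n

      step-left : ∀ {f} i k → i ≤ + n → i ≢ + n → D ≤ i + k → measure i k ≤ + suc f →
                  i + 1ℤ ≤ + n × D < i + 1ℤ + k × measure (i + 1ℤ) k ≤ + f
      step-left i k i≤n i≢n D≤i+k fuel =
        <⇒+1≤ (ZP.≤∧≢⇒< i≤n i≢n) ,
        subst (D <_) (shift i k) (ZP.≤-<-trans D≤i+k (i<i+1 (i + k))) ,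
        subst (_≤ _) (sym (measure-left i k)) (≤+suc⇒-1≤ fuel)
        where
          shift : ∀ i k → i + k + 1ℤ ≡ i + 1ℤ + k
          shift = solve-∀

      step-down : ∀ {f} i k → D < i + k → measure i k ≤ + suc f →
                  D ≤ i + (k - 1ℤ) × measure i (k - 1ℤ) ≤ + f
      step-down i k D<i+k fuel =
        subst (D ≤_) (ZP.+-assoc i k -1ℤ) (<⇒≤-1 D<i+k) ,
        subst (_≤ _) (sym (measure-down i k)) (≤+suc⇒-1≤ fuel)

    mutual
      lftL≡leftEdge : ∀ f i k → i ≤ + n → D ≤ i + k → measure i k ≤ + f → lftL f i k ≡ leftEdge S (i , k)
      lftL≡leftEdge f i k i≤n D≤i+k fuel with i ≟ + n
      ... | yes refl = sym (leftEdge-column-n A bd k)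
      lftL≡leftEdge zero i k i≤n D≤i+k fuel | no i≢n =
        contradiction fuel (ZP.<⇒≱ (measure-positive i k i≤n D≤i+k (inj₁ (ZP.≤∧≢⇒< i≤n i≢n))))
      lftL≡leftEdge (suc f) i k i≤n D≤i+k fuel | no i≢n
        with (i + 1ℤ , k) ∈? S | step-left i k i≤n i≢n D≤i+k fuel
      ... | yes c∈S | i+1≤n , D<i+1+k , fuel′ = begin
        lftL f (i + 1ℤ) k        ≡⟨ lftL≡leftEdge f (i + 1ℤ) k i+1≤n (ZP.<⇒≤ D<i+1+k) fuel′ ⟩
        leftEdge S (i + 1ℤ , k)  ≡⟨ proj₁ (crossing-edges A c∈S) ⟨
        rightEdge S (i + 1ℤ , k) ≡⟨ rightEdge-left-neighbour S i k ⟩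
        leftEdge S (i , k)       ∎
        where open ≡-Reasoning
      ... | no c∉S  | i+1≤n , D<i+1+k , fuel′ = begin
        botL f (i + 1ℤ) k         ≡⟨ botL≡bottomEdge f (i + 1ℤ) k i+1≤n D<i+1+k fuel′ ⟩
        bottomEdge S (i + 1ℤ , k) ≡⟨ proj₁ (elbow-edges A c∉S) ⟨
        rightEdge S (i + 1ℤ , k)  ≡⟨ rightEdge-left-neighbour S i k ⟩
        leftEdge S (i , k)        ∎
        where open ≡-Reasoning

      botL≡bottomEdge : ∀ f i k → i ≤ + n → D < i + k → measure i k ≤ + f → botL f i k ≡ bottomEdge S (i , k)
      botL≡bottomEdge zero i k i≤n D<i+k fuel =
        contradiction fuel (ZP.<⇒≱ (measure-positive i k i≤n (ZP.<⇒≤ D<i+k) (inj₂ D<i+k)))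
      botL≡bottomEdge (suc f) i k i≤n D<i+k fuel with step-down i k D<i+k fuel
      ... | D≤i+k-1 , fuel′ with i + (k - 1ℤ) ≟ D
      ...   | yes diagonal = begin
        lftL f i (k - 1ℤ)       ≡⟨ lftL≡leftEdge f i (k - 1ℤ) i≤n D≤i+k-1 fuel′ ⟩
        leftEdge S (i , k - 1ℤ) ≡⟨ proj₂ (elbow-edges {d = i , k - 1ℤ} A c∉S) ⟨
        topEdge S (i , k - 1ℤ)  ≡⟨ topEdge-lower-neighbour S i k ⟩
        bottomEdge S (i , k)    ∎
        where
          open ≡-Reasoning
          c∉S : (i , k - 1ℤ) ∉ S
          c∉S c∈S = ZP.<-irrefl (sym diagonal) (D<pos c∈S)
      ...   | no off-diagonal with (i , k - 1ℤ) ∈? S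
      ...     | yes c∈S = begin
        botL f i (k - 1ℤ)         ≡⟨ botL≡bottomEdge f i (k - 1ℤ) i≤n D<i+k-1 fuel′ ⟩
        bottomEdge S (i , k - 1ℤ) ≡⟨ proj₂ (crossing-edges A c∈S) ⟨
        topEdge S (i , k - 1ℤ)    ≡⟨ topEdge-lower-neighbour S i k ⟩
        bottomEdge S (i , k)      ∎
        where
          open ≡-Reasoning
          D<i+k-1 = ZP.≤∧≢⇒< D≤i+k-1 (λ e → off-diagonal (sym e))
      ...     | no c∉S = begin
        lftL f i (k - 1ℤ)       ≡⟨ lftL≡leftEdge f i (k - 1ℤ) i≤n D≤i+k-1 fuel′ ⟩
        leftEdge S (i , k - 1ℤ) ≡⟨ proj₂ (elbow-edges A c∉S) ⟨
        topEdge S (i , k - 1ℤ)  ≡⟨ topEdge-lower-neighbour S i k ⟩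
        bottomEdge S (i , k)    ∎
        where open ≡-Reasoning

  module _ {S : CellSet} (A : After S) (bd : Bounded S) (c : Cell) (col≤n : col c ≤ + n) where
    private
      chooseD<pos : d ∈ S → chooseD S c < pos d
      chooseD<pos d∈S = ZP.<-≤-trans (i-1<i _) (foldr-⊓-≤-member pos (pos c) S d∈S)

      chooseD<self : chooseD S c < pos c
      chooseD<self = ZP.<-≤-trans (i-1<i _) (foldr-⊓-≤-init pos (pos c) S)

    leftLabel≡leftEdge : leftLabel n S c ≡ leftEdge S c
    leftLabel≡leftEdge =
      lftL≡leftEdge A bd chooseD<pos _ (col c) (row c) col≤n (ZP.<⇒≤ chooseD<self) (i≤+∣i∣ _)

    bottomLabel≡bottomEdge : bottomLabel n S c ≡ bottomEdge S c
    bottomLabel≡bottomEdge =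
      botL≡bottomEdge A bd chooseD<pos _ (col c) (row c) col≤n chooseD<self (i≤+∣i∣ _)

-- Order of strands

module Strands (n : ℕ) (B : ℤ) where
  open Labelling n B

  Below : CellSet → ℤ → ℤ → ℤ → Set
  Below S t u v = position S t u < position S t v

  below? : ∀ S t u v → Dec (Below S t u v)
  below? S t u v = position S t u <? position S t v

  -- Strand u enters the crossing at (t , q) from the left, strand v from below.
  Crosses : CellSet → ℤ → ℤ → ℤ → ℤ → Set
  Crosses S t q u v = Crossing S t q × label S t (q + 1ℤ) ≡ u × label S t q ≡ v

  Meet : CellSet → ℤ → ℤ → ℤ → ℤ → Set
  Meet S t q u v = Crosses S t q u v ⊎ Crosses S t q v u

  meet-sym : ∀ {S t q u v} → Meet S t q u v → Meet S t q v u
  meet-sym (inj₁ c) = inj₂ c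
  meet-sym (inj₂ c) = inj₁ c

  meet⇒crossing : ∀ {S t q u v} → Meet S t q u v → Crossing S t q
  meet⇒crossing (inj₁ (c , _)) = c
  meet⇒crossing (inj₂ (c , _)) = c

  meet-map : ∀ {S S′ t t′ q q′ u v} (f : ℤ → ℤ) →
             (∀ {u v} → Crosses S t q u v → Crosses S′ t′ q′ (f u) (f v)) →
             Meet S t q u v → Meet S′ t′ q′ (f u) (f v)
  meet-map f g (inj₁ cr) = inj₁ (g cr)
  meet-map f g (inj₂ cr) = inj₂ (g cr)

  MeetOnce : CellSet → Set
  MeetOnce S = ∀ {t₁ q₁ t₂ q₂ u v} → Meet S t₁ q₁ u v → Meet S t₂ q₂ u v → t₁ ≡ t₂

  NonposApart : CellSet → Set
  NonposApart S = ∀ {t q u v} → Crosses S t q u v → u ≤ 0ℤ → v ≤ 0ℤ → ⊥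

  MeetBetween : CellSet → ℤ → ℤ → ℤ → ℤ → Set
  MeetBetween S t₁ t₂ u v = ∃ λ s → t₁ ≤ s × s < t₂ × ∃ λ q → Meet S s q u v

  MeetFree : CellSet → ℤ → ℤ → ℤ → ℤ → Set
  MeetFree S t₁ t₂ u v = ∀ s q → t₁ ≤ s → s < t₂ → ¬ Meet S s q u v

  data SameSide (S : CellSet) (t x y z : ℤ) : Set where
    below-both : Below S t x y → Below S t x z → SameSide S t x y z
    above-both : Below S t y x → Below S t z x → SameSide S t x y z

  module _ {S : CellSet} (A : After S) where
    crosses-positions : Crosses S t q u v → position S t u ≡ q + 1ℤ × position S t v ≡ q
    crosses-positions {t} {q} (_ , refl , refl) = position-label A t (q + 1ℤ) , position-label A t q

    crosses-positions-after : Crosses S t q u v → position S (t + 1ℤ) u ≡ q × position S (t + 1ℤ) v ≡ q + 1ℤ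
    crosses-positions-after {t} {q} {u} {v} cr@(c , _) =
      trans (position-step A t u) (trans (cong (swapAt S t) pos-u) (swapAt-down c)) ,
      trans (position-step A t v) (trans (cong (swapAt S t) pos-v) (swapAt-up c))
      where
        pos-u = proj₁ (crosses-positions cr)
        pos-v = proj₂ (crosses-positions cr)

    crosses-distinct : Crosses S t q u v → u ≢ v
    crosses-distinct {t} {q} cr refl =
      ZP.<-irrefl (trans (sym (proj₂ (crosses-positions cr))) (proj₁ (crosses-positions cr))) (i<i+1 q)

    meet-distinct : Meet S t q u v → u ≢ v
    meet-distinct (inj₁ cr) = crosses-distinct cr
    meet-distinct (inj₂ cr) e = crosses-distinct cr (sym e)

    meet-flips : Meet S t q u v → (Below S t u v → ¬ Below S (t + 1ℤ) u v) × (¬ Below S t u v → Below S (t + 1ℤ) u v)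
    meet-flips {q = q} (inj₁ cr) =
      (λ u<v _ → ZP.<-asym u<v (subst₂ _<_ (sym v-at) (sym u-at) (i<i+1 q))) ,
      (λ _ → subst₂ _<_ (sym u-after) (sym v-after) (i<i+1 q))
      where
        u-at = proj₁ (crosses-positions cr)
        v-at = proj₂ (crosses-positions cr)
        u-after = proj₁ (crosses-positions-after cr)
        v-after = proj₂ (crosses-positions-after cr)
    meet-flips {q = q} (inj₂ cr) =
      (λ _ u<v → ZP.<-asym u<v (subst₂ _<_ (sym v-after) (sym u-after) (i<i+1 q))) ,
      (λ u≮v → contradiction (subst₂ _<_ (sym u-at) (sym v-at) (i<i+1 q)) u≮v)
      where
        u-at = proj₂ (crosses-positions cr)
        v-at = proj₁ (crosses-positions cr)
        u-after = proj₂ (crosses-positions-after cr)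
        v-after = proj₁ (crosses-positions-after cr)

    order-change⇒crosses : Below S t u v → ¬ Below S (t + 1ℤ) u v → Crosses S t (position S t u) v u
    order-change⇒crosses {t} {u} {v} u<v u≮v with swapAt-monotone S t u<v
    ... | inj₁ lt = contradiction (subst₂ _<_ (sym (position-step A t u)) (sym (position-step A t v)) lt) u≮v
    ... | inj₂ (e , c) = c , trans (cong (label S t) (sym e)) (label-position A t v) , label-position A t u

    below-total : u ≢ v → ¬ Below S t u v → Below S t v u
    below-total {t = t} u≢v u≮v = ZP.≤∧≢⇒< (ZP.≮⇒≥ u≮v) (λ e → u≢v (position-injective A t (sym e)))

    order-change⇒meet : t₁ ≤ t₂ → Below S t₁ u v → ¬ Below S t₂ u v → MeetBetween S t₁ t₂ u v
    order-change⇒meet {t₁} {t₂} {u} {v} t₁≤t₂ =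
      ≥-induction (λ t → Below S t₁ u v → ¬ Below S t u v → MeetBetween S t₁ t u v)
        (λ u<v u≮v → contradiction u<v u≮v) step t₂ t₁≤t₂
      where
        step : ∀ t → t₁ ≤ t → (Below S t₁ u v → ¬ Below S t u v → MeetBetween S t₁ t u v) →
               Below S t₁ u v → ¬ Below S (t + 1ℤ) u v → MeetBetween S t₁ (t + 1ℤ) u v
        step t t₁≤t ih u<v₁ u≮v with below? S t u v
        ... | yes u<v = t , t₁≤t , i<i+1 t , position S t u , inj₂ (order-change⇒crosses u<v u≮v)
        ... | no u≮v′ with ih u<v₁ u≮v′
        ...   | s , t₁≤s , s<t , q , m = s , t₁≤s , ZP.<-trans s<t (i<i+1 t) , q , m

    order-change⇒meet′ : u ≢ v → t₁ ≤ t₂ → ¬ Below S t₁ u v → Below S t₂ u v → MeetBetween S t₁ t₂ u v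
    order-change⇒meet′ {u} {v} {t₁} u≢v t₁≤t₂ u≮v u<v
      with order-change⇒meet t₁≤t₂ (below-total {t = t₁} u≢v u≮v) (ZP.<-asym u<v)
    ... | s , t₁≤s , s<t₂ , q , m = s , t₁≤s , s<t₂ , q , meet-sym m

    below-preserved : t₁ ≤ t₂ → MeetFree S t₁ t₂ u v → Below S t₁ u v → Below S t₂ u v
    below-preserved {t₁} {t₂} {u} {v} t₁≤t₂ free u<v with below? S t₂ u v
    ... | yes u<v₂ = u<v₂
    ... | no u≮v₂ with order-change⇒meet t₁≤t₂ u<v u≮v₂
    ...   | s , t₁≤s , s<t₂ , q , m = contradiction m (free s q t₁≤s s<t₂)

    not-below-preserved : u ≢ v → t₁ ≤ t₂ → MeetFree S t₁ t₂ u v → ¬ Below S t₁ u v → ¬ Below S t₂ u v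
    not-below-preserved u≢v t₁≤t₂ free u≮v u<v with order-change⇒meet′ u≢v t₁≤t₂ u≮v u<v
    ... | s , t₁≤s , s<t₂ , q , m = free s q t₁≤s s<t₂ m

    below-initially : t ≤ B → u < v → Below S t u v
    below-initially {t} {u} {v} t≤B u<v =
      subst₂ _<_ (sym (position-before A t u t≤B)) (sym (position-before A t v t≤B))
        (ZP.+-monoˡ-< 1ℤ (ZP.+-monoˡ-< (+ n) u<v))

    adjacent-same-side : position S t y ≡ r + 1ℤ → position S t z ≡ r → x ≢ y → x ≢ z → SameSide S t x y z
    adjacent-same-side {t} {y} {r} {z} {x} y-at z-at x≢y x≢z with ZP.<-cmp (position S t x) r
    ... | tri< x<r _ _ = below-both (subst (_ <_) (sym y-at) (ZP.<-trans x<r (i<i+1 r))) (subst (_ <_) (sym z-at) x<r)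
    ... | tri≈ _ x≡r _ = contradiction (position-injective A t (trans x≡r (sym z-at))) x≢z
    ... | tri> _ _ r<x = above-both (subst (_< _) (sym y-at) r+1<x) (subst (_< _) (sym z-at) r<x)
      where
        r+1<x = ZP.≤∧≢⇒< (<⇒+1≤ r<x) (λ e → x≢y (position-injective A t (trans (sym e) (sym y-at))))

    same-side-sym : SameSide S t x y z → SameSide S t x z y
    same-side-sym (below-both x<y x<z) = below-both x<z x<y
    same-side-sym (above-both y<x z<x) = above-both z<x y<x

    same-side⇒iff : SameSide S t x y z → (Below S t x y → Below S t x z) × (Below S t x z → Below S t x y)
    same-side⇒iff (below-both x<y x<z) = (λ _ → x<z) , (λ _ → x<y)
    same-side⇒iff (above-both y<x z<x) = (λ x<y → contradiction y<x (ZP.<-asym x<y)) ,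
                                        (λ x<z → contradiction z<x (ZP.<-asym x<z))

    meet-same-side : Meet S t p y z → x ≢ y → x ≢ z → SameSide S t x y z
    meet-same-side {t} {p} {y} {z} {x} (inj₁ cr) x≢y x≢z =
      adjacent-same-side {t} {y} {p} {z} {x}
        (proj₁ (crosses-positions cr)) (proj₂ (crosses-positions cr)) x≢y x≢z
    meet-same-side {t} {p} {y} {z} {x} (inj₂ cr) x≢y x≢z =
      same-side-sym (adjacent-same-side {t} {z} {p} {y} {x}
                       (proj₁ (crosses-positions cr)) (proj₂ (crosses-positions cr)) x≢z x≢y)

    meet-position : Meet S t q u v → position S t u ≡ q + 1ℤ ⊎ position S t u ≡ q
    meet-position (inj₁ cr) = inj₁ (proj₁ (crosses-positions cr))
    meet-position (inj₂ cr) = inj₂ (proj₂ (crosses-positions cr))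

    meets-sharing-strand : ∀ {q q′} → Meet S t q u v → Meet S t q′ u w → q ≡ q′
    meets-sharing-strand {t} m m′ with meet-position m | meet-position m′
    ... | inj₁ e | inj₁ e′ = +1-injective (trans (sym e) e′)
    ... | inj₂ e | inj₂ e′ = trans (sym e) e′
    ... | inj₁ e | inj₂ e′ = contradiction (subst (Crossing S t) (trans (sym e′) e) (meet⇒crossing m′))
                                           (no-adjacent-crossings (meet⇒crossing m))
    ... | inj₂ e | inj₁ e′ = contradiction (subst (Crossing S t) (trans (sym e) e′) (meet⇒crossing m))
                                           (no-adjacent-crossings (meet⇒crossing m′))

    module _ (once : MeetOnce S) where
      meet-free-elsewhen : Meet S s p u v → (∀ s′ → t₁ ≤ s′ → s′ < t₂ → s′ ≢ s) → MeetFree S t₁ t₂ u v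
      meet-free-elsewhen m away s′ q′ t₁≤s′ s′<t₂ m′ = away s′ t₁≤s′ s′<t₂ (once m′ m)

      meet-flips-order : Meet S s p u v → t₁ ≤ s → s < t₂ →
                         (Below S t₁ u v → ¬ Below S t₂ u v) × (¬ Below S t₁ u v → Below S t₂ u v)
      meet-flips-order {s} {u = u} {v} {t₁} {t₂} m t₁≤s s<t₂ =
        (λ u<v → not-below-preserved u≢v s+1≤t₂ free-after
                   (proj₁ (meet-flips m) (below-preserved t₁≤s free-before u<v))) ,
        (λ u≮v → below-preserved s+1≤t₂ free-after
                   (proj₂ (meet-flips m) (not-below-preserved u≢v t₁≤s free-before u≮v)))
        where
          u≢v = meet-distinct m
          s+1≤t₂ = <⇒+1≤ s<t₂
          free-before : MeetFree S t₁ s u v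
          free-before = meet-free-elsewhen m (λ s′ _ s′<s → ZP.<⇒≢ s′<s)
          free-after : MeetFree S (s + 1ℤ) t₂ u v
          free-after = meet-free-elsewhen m (λ s′ s+1≤s′ _ e → ZP.<-irrefl (sym e) (ZP.<-≤-trans (i<i+1 s) s+1≤s′))

-- Adding one crossing

transpose : ℤ → ℤ → ℤ → ℤ
transpose a b x with x ≟ a | x ≟ b
... | yes _ | _     = b
... | no _  | yes _ = a
... | no _  | no _  = x

data TransposeView (a b x : ℤ) : Set where
  first  : x ≡ a → transpose a b x ≡ b → TransposeView a b x
  second : x ≡ b → transpose a b x ≡ a → TransposeView a b x
  other  : x ≢ a → x ≢ b → transpose a b x ≡ x → TransposeView a b x

transpose-first : ∀ a b → transpose a b a ≡ b
transpose-first a b with a ≟ a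
... | yes _ = refl
... | no a≢a = contradiction refl a≢a

transpose-second : ∀ {a b} → a ≢ b → transpose a b b ≡ a
transpose-second {a} {b} a≢b with b ≟ a | b ≟ b
... | yes b≡a | _     = contradiction (sym b≡a) a≢b
... | no _    | yes _ = refl
... | no _    | no b≢b = contradiction refl b≢b

transpose-other : ∀ {a b} → x ≢ a → x ≢ b → transpose a b x ≡ x
transpose-other {x} {a} {b} x≢a x≢b with x ≟ a | x ≟ b
... | yes x≡a | _     = contradiction x≡a x≢a
... | no _    | yes x≡b = contradiction x≡b x≢b
... | no _    | no _  = refl

transpose-view : ∀ a b x → a ≢ b → TransposeView a b x
transpose-view a b x a≢b with x ≟ a | x ≟ b
... | yes refl | _      = first refl (transpose-first a b)
... | no _     | yes refl = second refl (transpose-second a≢b)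
... | no x≢a   | no x≢b = other x≢a x≢b (transpose-other x≢a x≢b)

transpose-involutive : ∀ {a b} → a ≢ b → ∀ x → transpose a b (transpose a b x) ≡ x
transpose-involutive {a} {b} a≢b x with transpose-view a b x a≢b
... | first refl e    = trans (cong (transpose a b) e) (transpose-second a≢b)
... | second refl e   = trans (cong (transpose a b) e) (transpose-first a b)
... | other _ _ e     = trans (cong (transpose a b) e) e

transpose-comm : ∀ {a b} → a ≢ b → ∀ x → transpose a b x ≡ transpose b a x
transpose-comm {a} {b} a≢b x with transpose-view a b x a≢b
... | first refl e    = trans e (sym (transpose-second (λ e → a≢b (sym e))))
... | second refl e   = trans e (sym (transpose-first b a))
... | other x≢a x≢b e = trans e (sym (transpose-other x≢b x≢a))

record Adds (T S : CellSet) (t₀ q : ℤ) : Set where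
  field
    kept  : ∀ {t p} → Crossing T t p → Crossing S t p
    added : ∀ {t p} → Crossing S t p → Crossing T t p ⊎ (t ≡ t₀ × p ≡ q)
    new   : Crossing S t₀ q
    fresh : ¬ Crossing T t₀ q

module Adding (n : ℕ) (B : ℤ) where
  open Labelling n B
  open Strands n B

  module AddCrossing {T S : CellSet} {t₀ q : ℤ} (add : Adds T S t₀ q) (AS : After S) (AT : After T) where
    open Adds add

    old : ¬ (t ≡ t₀ × p ≡ q) → Crossing S t p → Crossing T t p
    old ≢new c with added c
    ... | inj₁ c′ = c′
    ... | inj₂ e  = contradiction e ≢new

    swapAt-elsewhen : t ≢ t₀ → swapAt S t p ≡ swapAt T t p
    swapAt-elsewhen t≢t₀ = swapAt-local (old (t≢t₀ ∘ proj₁)) kept (old (t≢t₀ ∘ proj₁)) kept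

    a b : ℤ
    a = label T t₀ (q + 1ℤ)
    b = label T t₀ q

    a≢b : a ≢ b
    a≢b e = ZP.<-irrefl (sym (label-injective AT t₀ e)) (i<i+1 q)

    label-early : ∀ t → t ≤ t₀ → ∀ p → label S t p ≡ label T t p
    label-early = induction-above (λ t → t ≤ t₀ → ∀ p → label S t p ≡ label T t p) B before step
      where
        before : ∀ t → t ≤ B → t ≤ t₀ → ∀ p → label S t p ≡ label T t p
        before t t≤B _ p = trans (label-before AS t p t≤B) (sym (label-before AT t p t≤B))
        step : ∀ t → B ≤ t → (t ≤ t₀ → ∀ p → label S t p ≡ label T t p) →
               t + 1ℤ ≤ t₀ → ∀ p → label S (t + 1ℤ) p ≡ label T (t + 1ℤ) p
        step t _ ih t+1≤t₀ p = begin
          label S (t + 1ℤ) p       ≡⟨ label-step AS t p ⟩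
          label S t (swapAt S t p) ≡⟨ cong (label S t) (swapAt-elsewhen (ZP.<⇒≢ t<t₀)) ⟩
          label S t (swapAt T t p) ≡⟨ ih (ZP.<⇒≤ t<t₀) _ ⟩
          label T t (swapAt T t p) ≡⟨ label-step AT t p ⟨
          label T (t + 1ℤ) p       ∎
          where
            open ≡-Reasoning
            t<t₀ = ZP.<-≤-trans (i<i+1 t) t+1≤t₀

    swapAt-T-fresh : swapAt T t₀ q ≡ q × swapAt T t₀ (q + 1ℤ) ≡ q + 1ℤ
    swapAt-T-fresh = swapAt-vacant (proj₂ (proj₂ (find new))) fresh

    private
      label-T-fresh : label T t₀ (swapAt T t₀ x) ≡ a ⊎ label T t₀ (swapAt T t₀ x) ≡ b →
                      x ≡ q + 1ℤ ⊎ x ≡ q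
      label-T-fresh {x} (inj₁ e) = inj₁ (trans (sym (swapAt-involutive T t₀ x))
        (trans (cong (swapAt T t₀) (label-injective AT t₀ e)) (proj₂ swapAt-T-fresh)))
      label-T-fresh {x} (inj₂ e) = inj₂ (trans (sym (swapAt-involutive T t₀ x))
        (trans (cong (swapAt T t₀) (label-injective AT t₀ e)) (proj₁ swapAt-T-fresh)))

      swapAt-new : ∀ p → label T t₀ (swapAt S t₀ p) ≡ transpose a b (label T t₀ (swapAt T t₀ p))
      swapAt-new p with p ≟ q | p ≟ q + 1ℤ
      ... | yes refl | _ = begin
        label T t₀ (swapAt S t₀ q)                 ≡⟨ cong (label T t₀) (swapAt-up new) ⟩
        a                                          ≡⟨ transpose-second a≢b ⟨
        transpose a b b                            ≡⟨ cong (λ r → transpose a b (label T t₀ r)) (proj₁ swapAt-T-fresh) ⟨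
        transpose a b (label T t₀ (swapAt T t₀ q)) ∎
        where open ≡-Reasoning
      ... | no _ | yes refl = begin
        label T t₀ (swapAt S t₀ (q + 1ℤ))                 ≡⟨ cong (label T t₀) (swapAt-down new) ⟩
        b                                                 ≡⟨ transpose-first a b ⟨
        transpose a b a                                   ≡⟨ cong (λ r → transpose a b (label T t₀ r)) (proj₂ swapAt-T-fresh) ⟨
        transpose a b (label T t₀ (swapAt T t₀ (q + 1ℤ))) ∎
        where open ≡-Reasoning
      ... | no p≢q | no p≢q+1 = begin
        label T t₀ (swapAt S t₀ p)                 ≡⟨ cong (label T t₀) (swapAt-local (old (p≢q ∘ proj₂)) kept (old p-1≢q) kept) ⟩
        label T t₀ (swapAt T t₀ p)                 ≡⟨ transpose-other (λ e → ≢q (inj₁ e)) (λ e → ≢q (inj₂ e)) ⟨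
        transpose a b (label T t₀ (swapAt T t₀ p)) ∎
        where
          open ≡-Reasoning
          p-1≢q : ¬ (t₀ ≡ t₀ × p - 1ℤ ≡ q)
          p-1≢q (_ , e) = p≢q+1 (trans (sym (i-1+1≡i p)) (cong (_+ 1ℤ) e))
          ≢q : ¬ (label T t₀ (swapAt T t₀ p) ≡ a ⊎ label T t₀ (swapAt T t₀ p) ≡ b)
          ≢q e with label-T-fresh e
          ... | inj₁ e′ = p≢q+1 e′
          ... | inj₂ e′ = p≢q e′

    label-across-new : ∀ p → label S (t₀ + 1ℤ) p ≡ transpose a b (label T (t₀ + 1ℤ) p)
    label-across-new p = begin
      label S (t₀ + 1ℤ) p                         ≡⟨ label-step AS t₀ p ⟩
      label S t₀ (swapAt S t₀ p)                  ≡⟨ label-early t₀ ZP.≤-refl _ ⟩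
      label T t₀ (swapAt S t₀ p)                  ≡⟨ swapAt-new p ⟩
      transpose a b (label T t₀ (swapAt T t₀ p))  ≡⟨ cong (transpose a b) (label-step AT t₀ p) ⟨
      transpose a b (label T (t₀ + 1ℤ) p)         ∎
      where open ≡-Reasoning

    label-late : ∀ t → t₀ < t → ∀ p → label S t p ≡ transpose a b (label T t p)
    label-late t t₀<t =
      ≥-induction (λ t → ∀ p → label S t p ≡ transpose a b (label T t p)) label-across-new step t (<⇒+1≤ t₀<t)
      where
        step : ∀ t → t₀ + 1ℤ ≤ t → (∀ p → label S t p ≡ transpose a b (label T t p)) →
               ∀ p → label S (t + 1ℤ) p ≡ transpose a b (label T (t + 1ℤ) p)
        step t t₀+1≤t ih p = begin
          label S (t + 1ℤ) p                        ≡⟨ label-step AS t p ⟩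
          label S t (swapAt S t p)                  ≡⟨ cong (label S t) (swapAt-elsewhen (λ e → ZP.<⇒≢ t₀<t′ (sym e))) ⟩
          label S t (swapAt T t p)                  ≡⟨ ih _ ⟩
          transpose a b (label T t (swapAt T t p))  ≡⟨ cong (transpose a b) (label-step AT t p) ⟨
          transpose a b (label T (t + 1ℤ) p)        ∎
          where
            open ≡-Reasoning
            t₀<t′ = ZP.<-≤-trans (i<i+1 t₀) t₀+1≤t

    private
      untranspose : ∀ {x y} → x ≡ transpose a b y → transpose a b x ≡ y
      untranspose {x} {y} e = trans (cong (transpose a b) e) (transpose-involutive a≢b y)

    crosses-S⇒T-early : t ≤ t₀ → ¬ (t ≡ t₀ × p ≡ q) → Crosses S t p u v → Crosses T t p u v
    crosses-S⇒T-early {t} {p} t≤t₀ ≢new (c , refl , refl) =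
      old ≢new c , sym (label-early t t≤t₀ (p + 1ℤ)) , sym (label-early t t≤t₀ p)

    crosses-T⇒S-early : t ≤ t₀ → Crosses T t p u v → Crosses S t p u v
    crosses-T⇒S-early {t} {p} t≤t₀ (c , refl , refl) =
      kept c , label-early t t≤t₀ (p + 1ℤ) , label-early t t≤t₀ p

    crosses-S⇒T-late : t₀ < t → Crosses S t p u v → Crosses T t p (transpose a b u) (transpose a b v)
    crosses-S⇒T-late {t} {p} t₀<t (c , refl , refl) =
      old (λ e → ZP.<⇒≢ t₀<t (sym (proj₁ e))) c ,
      sym (untranspose (label-late t t₀<t (p + 1ℤ))) , sym (untranspose (label-late t t₀<t p))

    crosses-T⇒S-late : t₀ < t → Crosses T t p u v → Crosses S t p (transpose a b u) (transpose a b v)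
    crosses-T⇒S-late {t} {p} t₀<t (c , refl , refl) =
      kept c , label-late t t₀<t (p + 1ℤ) , label-late t t₀<t p

    new-crosses : Crosses S t₀ q a b
    new-crosses = new , label-early t₀ ZP.≤-refl (q + 1ℤ) , label-early t₀ ZP.≤-refl q

    meet-ab-S⇒T-late : t₀ < t → Meet S t p a b → Meet T t p a b
    meet-ab-S⇒T-late t₀<t m =
      meet-sym (subst₂ (Meet T _ _) (transpose-first a b) (transpose-second a≢b)
                       (meet-map (transpose a b) (crosses-S⇒T-late t₀<t) m))

    meet-ab-T⇒S-late : t₀ < t → Meet T t p a b → Meet S t p a b
    meet-ab-T⇒S-late t₀<t m =
      meet-sym (subst₂ (Meet S _ _) (transpose-first a b) (transpose-second a≢b)
                       (meet-map (transpose a b) (crosses-T⇒S-late t₀<t) m))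

-- One step of the insertion

module Insertion (n : ℕ) (B : ℤ) where
  open Labelling n B
  open Strands n B
  open Adding n B

  module Step {T S : CellSet} {t₀ q : ℤ} (add : Adds T S t₀ q) (AS : After S) (AT : After T)
              (once : MeetOnce T) (apart : NonposApart T)
              (a-pos : 0ℤ < label T t₀ (q + 1ℤ)) (b-nonpos : label T t₀ q ≤ 0ℤ) where
    open Adds add
    open AddCrossing add AS AT public

    a-at : position T t₀ a ≡ q + 1ℤ
    a-at = position-label AT t₀ (q + 1ℤ)

    b-at : position T t₀ b ≡ q
    b-at = position-label AT t₀ q

    a-at′ : position T (t₀ + 1ℤ) a ≡ q + 1ℤ
    a-at′ = trans (position-step AT t₀ a) (trans (cong (swapAt T t₀) a-at) (proj₂ swapAt-T-fresh))

    b-at′ : position T (t₀ + 1ℤ) b ≡ q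
    b-at′ = trans (position-step AT t₀ b) (trans (cong (swapAt T t₀) b-at) (proj₁ swapAt-T-fresh))

    nonpos≢a : x ≤ 0ℤ → x ≢ a
    nonpos≢a x≤0 refl = ZP.<⇒≱ a-pos x≤0

    b<a : b < a
    b<a = ZP.≤-<-trans b-nonpos a-pos

    b-below-a : Below T t₀ b a
    b-below-a = subst₂ _<_ (sym b-at) (sym a-at) (i<i+1 q)

    nonpos-never-meet : u ≤ 0ℤ → v ≤ 0ℤ → ¬ Meet T t p u v
    nonpos-never-meet u≤0 v≤0 (inj₁ cr) = apart cr u≤0 v≤0
    nonpos-never-meet u≤0 v≤0 (inj₂ cr) = apart cr v≤0 u≤0

    no-meet-ab-at-t₀ : ¬ Meet T t₀ p a b
    no-meet-ab-at-t₀ (inj₁ cr) =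
      fresh (subst (Crossing T t₀) (trans (sym (proj₂ (crosses-positions AT cr))) b-at) (proj₁ cr))
    no-meet-ab-at-t₀ {p} (inj₂ cr) = ZP.<-asym p<q q<p
      where
        p<q = subst (p <_) (trans (sym (proj₁ (crosses-positions AT cr))) b-at) (i<i+1 p)
        q<p = subst (q <_) (trans (sym a-at) (proj₂ (crosses-positions AT cr))) (i<i+1 q)

    -- b is below a both initially and at t₀, so a crossing before t₀ would need a second one.
    no-early-meet-ab : t ≤ t₀ → ¬ Meet T t p a b
    no-early-meet-ab {t} t≤t₀ m with t ≟ t₀
    ... | yes refl = no-meet-ab-at-t₀ m
    ... | no t≢t₀  = proj₁ (meet-flips-order AT once (meet-sym m) (AT (meet⇒crossing m)) (ZP.≤∧≢⇒< t≤t₀ t≢t₀))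
                       (below-initially AT ZP.≤-refl b<a) b-below-a

    -- If x starts below b it stays below b, which puts b above a when x meets a;
    -- if x starts above b it starts above a as well, and then a and x cross twice.
    meet-a-nonpos⇒meet-ab : x ≤ 0ℤ → x ≢ b → t₀ < t → Meet T t p a x → MeetBetween T (t₀ + 1ℤ) t a b
    meet-a-nonpos⇒meet-ab {x} {t} {p} x≤0 x≢b t₀<t m with below? T t₀ x b
    ... | yes x<b with order-change⇒meet′ AT a≢b (ZP.<⇒≤ t₀<t) (ZP.<-asym b-below-a) a-below-b-at-t
      where
        x-below-b-at-t : Below T t x b
        x-below-b-at-t = below-preserved AT (ZP.<⇒≤ t₀<t) (λ _ _ _ _ → nonpos-never-meet x≤0 b-nonpos) x<b
        a-below-b-at-t : Below T t a b
        a-below-b-at-t with meet-same-side AT m (λ e → a≢b (sym e)) (λ e → x≢b (sym e))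
        ... | below-both _ b<x  = contradiction b<x (ZP.<-asym x-below-b-at-t)
        ... | above-both a<b _  = a<b
    ... | s , t₀≤s , s<t , p′ , m-ab = s , <⇒+1≤ t₀<s , s<t , p′ , m-ab
      where
        t₀<s = ZP.≤∧≢⇒< t₀≤s (λ { refl → no-meet-ab-at-t₀ m-ab })
    meet-a-nonpos⇒meet-ab {x} {t} {p} x≤0 x≢b t₀<t m | no x≮b
      with order-change⇒meet AT (AS new) (below-initially AT ZP.≤-refl (ZP.≤-<-trans x≤0 a-pos)) (ZP.<-asym a-below-x)
      where
        a-below-x : Below T t₀ a x
        a-below-x with adjacent-same-side AT {t₀} {a} {q} {b} {x} a-at b-at (nonpos≢a x≤0) x≢b
        ... | below-both _ x<b = contradiction x<b x≮b
        ... | above-both a<x _ = a<x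
    ... | s , _ , s<t₀ , _ , m-xa = contradiction (once m-xa (meet-sym m)) (ZP.<⇒≢ (ZP.<-trans s<t₀ t₀<t))

    late-nonpos-meet⇒meet-ab : t₀ < t → Meet T t p (transpose a b u) (transpose a b v) → u ≤ 0ℤ → v ≤ 0ℤ →
                               MeetBetween T (t₀ + 1ℤ) t a b
    late-nonpos-meet⇒meet-ab {t} {p} {u} {v} t₀<t m u≤0 v≤0
      with transpose-view a b u a≢b | transpose-view a b v a≢b
    ... | first u≡a _ | _ = contradiction u≡a (nonpos≢a u≤0)
    ... | _ | first v≡a _ = contradiction v≡a (nonpos≢a v≤0)
    ... | second _ τu≡a | second _ τv≡a = contradiction (trans τu≡a (sym τv≡a)) (meet-distinct AT m)
    ... | second _ τu≡a | other _ v≢b τv≡v =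
      meet-a-nonpos⇒meet-ab v≤0 v≢b t₀<t (subst₂ (Meet T t p) τu≡a τv≡v m)
    ... | other _ u≢b τu≡u | second _ τv≡a =
      meet-a-nonpos⇒meet-ab u≤0 u≢b t₀<t (meet-sym (subst₂ (Meet T t p) τu≡u τv≡a m))
    ... | other _ _ τu≡u | other _ _ τv≡v =
      contradiction (subst₂ (Meet T t p) τu≡u τv≡v m) (nonpos-never-meet u≤0 v≤0)

    stop-case : MeetOnce S → NonposApart S
    stop-case onceS {t} {p} {u} {v} cr u≤0 v≤0 with t ≤? t₀
    ... | yes t≤t₀ with (t ≟ t₀) ×-dec (p ≟ q)
    ...   | yes (refl , refl) = nonpos≢a u≤0 (trans (sym (proj₁ (proj₂ cr))) (proj₁ (proj₂ new-crosses)))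
    ...   | no ≢new = apart (crosses-S⇒T-early t≤t₀ ≢new cr) u≤0 v≤0
    stop-case onceS {t} {p} {u} {v} cr u≤0 v≤0 | no t≰t₀
      with late-nonpos-meet⇒meet-ab t₀<t (inj₁ (crosses-S⇒T-late t₀<t cr)) u≤0 v≤0
      where t₀<t = ZP.≰⇒> t≰t₀
    ... | s , t₀+1≤s , _ , _ , m-ab =
      ZP.<-irrefl (onceS (inj₁ new-crosses) (meet-ab-T⇒S-late t₀<s m-ab)) t₀<s
      where t₀<s = ZP.<-≤-trans (i<i+1 t₀) t₀+1≤s

    -- If S is not an rc-graph, a and b cross a second time, at (t′ , q′).
    module Bump {t′ q′ : ℤ} (m′ : Meet S t′ q′ a b) (≢new : ¬ (t′ ≡ t₀ × q′ ≡ q)) where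
      private
        late-in-T : t₀ < t′ × Meet T t′ q′ a b
        late-in-T with t′ ≤? t₀
        ... | yes t′≤t₀ = contradiction (meet-map id (crosses-S⇒T-early t′≤t₀ ≢new) m′) (no-early-meet-ab t′≤t₀)
        ... | no t′≰t₀  = ZP.≰⇒> t′≰t₀ , meet-ab-S⇒T-late (ZP.≰⇒> t′≰t₀) m′

      t₀<t′ : t₀ < t′
      t₀<t′ = proj₁ late-in-T

      meet-ab : Meet T t′ q′ a b
      meet-ab = proj₂ late-in-T

      meet-ab-only-at-t′ : Meet T t p a b → t ≡ t′ × p ≡ q′
      meet-ab-only-at-t′ m with once m meet-ab
      ... | refl = refl , meets-sharing-strand AT m meet-ab

      Outer : ℤ → Set
      Outer t = t ≤ t₀ ⊎ t′ < t

      outer-no-meet-ab : Outer t → ¬ Meet T t p a b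
      outer-no-meet-ab o m with proj₁ (meet-ab-only-at-t′ m) | o
      ... | refl | inj₁ t′≤t₀ = ZP.<⇒≱ t₀<t′ t′≤t₀
      ... | refl | inj₂ t′<t′ = ZP.<-irrefl refl t′<t′

      meet-before-t′ : ∀ {y w} → t ≤ t′ → ¬ (t ≡ t′ × p ≡ q′) → Meet T t p y x → Meet T t′ q′ y w → t < t′
      meet-before-t′ {t} t≤t′ ≢removed m m-y with t ≟ t′
      ... | yes refl = contradiction (refl , meets-sharing-strand AT m m-y) ≢removed
      ... | no t≢t′  = ZP.≤∧≢⇒< t≤t′ t≢t′

      same-side-ab : x ≢ a → x ≢ b → SameSide T (t₀ + 1ℤ) x a b × SameSide T t′ x a b
      same-side-ab {x} x≢a x≢b =
        adjacent-same-side AT {t₀ + 1ℤ} {a} {q} {b} {x} a-at′ b-at′ x≢a x≢b , meet-same-side AT meet-ab x≢a x≢b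

      -- Between t₀ + 1 and t′ the strands a and b sit on the same side of any other strand x,
      -- so x cannot cross exactly one of them in that interval.
      no-single-flip : ∀ {y y′} → x ≢ y → x ≢ y′ → SameSide T (t₀ + 1ℤ) x y y′ → SameSide T t′ x y y′ →
                       Outer t₁ → Meet T t₁ p₁ y x → t₀ < t₂ → t₂ < t′ → Meet T t₂ p₂ y′ x → ⊥
      no-single-flip {x} {t₁} {p₁} {t₂} {p₂} {y} {y′} x≢y x≢y′ side₀ side′ o m₁ t₀<t₂ t₂<t′ m₂ =
        decide (below? T (t₀ + 1ℤ) x y)
        where
          iff₀ = same-side⇒iff AT side₀
          iff′ = same-side⇒iff AT side′
          t₀+1≤t′ = <⇒+1≤ t₀<t′
          y′-flips = meet-flips-order AT once (meet-sym m₂) (<⇒+1≤ t₀<t₂) t₂<t′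
          y-fixed : MeetFree T (t₀ + 1ℤ) t′ x y
          y-fixed s _ t₀+1≤s s<t′ m = inside (once m (meet-sym m₁)) o
            where
              inside : s ≡ t₁ → ¬ Outer t₁
              inside refl (inj₁ s≤t₀) = ZP.<⇒≱ (ZP.<-≤-trans (i<i+1 t₀) t₀+1≤s) s≤t₀
              inside refl (inj₂ t′<s) = ZP.<-asym s<t′ t′<s
          decide : Dec (Below T (t₀ + 1ℤ) x y) → ⊥
          decide (yes x<y) =
            proj₁ y′-flips (proj₁ iff₀ x<y) (proj₁ iff′ (below-preserved AT t₀+1≤t′ y-fixed x<y))
          decide (no x≮y) =
            not-below-preserved AT x≢y t₀+1≤t′ y-fixed x≮y
              (proj₂ iff′ (proj₂ y′-flips (λ x<y′ → x≮y (proj₂ iff₀ x<y′))))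

      private
        no-flip-a-b : x ≢ a → x ≢ b → Outer t₁ → Meet T t₁ p₁ a x →
                      t₀ < t₂ → t₂ ≤ t′ → ¬ (t₂ ≡ t′ × p₂ ≡ q′) → Meet T t₂ p₂ b x → ⊥
        no-flip-a-b x≢a x≢b o m₁ t₀<t₂ t₂≤t′ ≢removed m₂ =
          no-single-flip x≢a x≢b (proj₁ sides) (proj₂ sides) o m₁ t₀<t₂
            (meet-before-t′ t₂≤t′ ≢removed m₂ (meet-sym meet-ab)) m₂
          where sides = same-side-ab x≢a x≢b

        no-flip-b-a : x ≢ a → x ≢ b → Outer t₁ → Meet T t₁ p₁ b x →
                      t₀ < t₂ → t₂ ≤ t′ → ¬ (t₂ ≡ t′ × p₂ ≡ q′) → Meet T t₂ p₂ a x → ⊥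
        no-flip-b-a x≢a x≢b o m₁ t₀<t₂ t₂≤t′ ≢removed m₂ =
          no-single-flip x≢b x≢a (same-side-sym AT (proj₁ sides)) (same-side-sym AT (proj₂ sides)) o m₁ t₀<t₂
            (meet-before-t′ t₂≤t′ ≢removed m₂ meet-ab) m₂
          where sides = same-side-ab x≢a x≢b

      outer-inner-meets : Outer t₁ → Meet T t₁ p₁ u v → t₀ < t₂ → t₂ ≤ t′ → ¬ (t₂ ≡ t′ × p₂ ≡ q′) →
                          Meet T t₂ p₂ (transpose a b u) (transpose a b v) → t₁ ≡ t₂
      outer-inner-meets {u = u} {v = v} {t₂ = t₂} {p₂ = p₂} o m₁ t₀<t₂ t₂≤t′ ≢removed m₂
        with transpose-view a b u a≢b | transpose-view a b v a≢b
      ... | first refl _  | first refl _  = contradiction refl (meet-distinct AT m₁)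
      ... | second refl _ | second refl _ = contradiction refl (meet-distinct AT m₁)
      ... | first refl _  | second refl _ = contradiction m₁ (outer-no-meet-ab o)
      ... | second refl _ | first refl _  = contradiction (meet-sym m₁) (outer-no-meet-ab o)
      ... | first refl τa | other x≢a x≢b τx =
        ⊥-elim (no-flip-a-b x≢a x≢b o m₁ t₀<t₂ t₂≤t′ ≢removed (subst₂ (Meet T t₂ p₂) τa τx m₂))
      ... | second refl τb | other x≢a x≢b τx =
        ⊥-elim (no-flip-b-a x≢a x≢b o m₁ t₀<t₂ t₂≤t′ ≢removed (subst₂ (Meet T t₂ p₂) τb τx m₂))
      ... | other x≢a x≢b τx | first refl τa =
        ⊥-elim (no-flip-a-b x≢a x≢b o (meet-sym m₁) t₀<t₂ t₂≤t′ ≢removed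
                  (meet-sym (subst₂ (Meet T t₂ p₂) τx τa m₂)))
      ... | other x≢a x≢b τx | second refl τb =
        ⊥-elim (no-flip-b-a x≢a x≢b o (meet-sym m₁) t₀<t₂ t₂≤t′ ≢removed
                  (meet-sym (subst₂ (Meet T t₂ p₂) τx τb m₂)))
      ... | other _ _ τu | other _ _ τv = once m₁ (subst₂ (Meet T t₂ p₂) τu τv m₂)

      -- Between t₀ and t′ the labels of T′ are those of T with a and b exchanged.
      module Removal {T′ : CellSet} (rem : Adds T′ S t′ q′) (AT′ : After T′) where
        private
          module R = AddCrossing rem AS AT′

        transpose-removed : ∀ x → transpose R.a R.b x ≡ transpose a b x
        transpose-removed x = by-orientation m′
          where
            same-left : ∀ {u} → label S t′ (q′ + 1ℤ) ≡ u → R.a ≡ u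
            same-left = trans (sym (proj₁ (proj₂ R.new-crosses)))
            same-bottom : ∀ {v} → label S t′ q′ ≡ v → R.b ≡ v
            same-bottom = trans (sym (proj₂ (proj₂ R.new-crosses)))
            by-orientation : Meet S t′ q′ a b → transpose R.a R.b x ≡ transpose a b x
            by-orientation (inj₁ (_ , ea , eb)) = cong₂ (λ u v → transpose u v x) (same-left ea) (same-bottom eb)
            by-orientation (inj₂ (_ , eb , ea)) =
              trans (cong₂ (λ u v → transpose u v x) (same-left eb) (same-bottom ea)) (sym (transpose-comm a≢b x))

        crosses-early : t ≤ t₀ → ¬ (t ≡ t₀ × p ≡ q) → Crosses T′ t p u v → Crosses T t p u v
        crosses-early t≤t₀ ≢new = crosses-S⇒T-early t≤t₀ ≢new ∘ R.crosses-T⇒S-early (ZP.≤-trans t≤t₀ (ZP.<⇒≤ t₀<t′))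

        crosses-inner : t₀ < t → t ≤ t′ → Crosses T′ t p u v → Crosses T t p (transpose a b u) (transpose a b v)
        crosses-inner t₀<t t≤t′ = crosses-S⇒T-late t₀<t ∘ R.crosses-T⇒S-early t≤t′

        crosses-late : t′ < t → Crosses T′ t p u v → Crosses T t p u v
        crosses-late {t} {p = p} {u} {v} t′<t cr =
          subst₂ (Crosses T t p) (untwist u) (untwist v)
            (crosses-S⇒T-late (ZP.<-trans t₀<t′ t′<t) (R.crosses-T⇒S-late t′<t cr))
          where
            untwist : ∀ x → transpose a b (transpose R.a R.b x) ≡ x
            untwist x = trans (cong (transpose a b) (transpose-removed x)) (transpose-involutive a≢b x)

        crosses-at-new : Crosses T′ t₀ q u v → u ≡ a × v ≡ b
        crosses-at-new cr with R.crosses-T⇒S-early (ZP.<⇒≤ t₀<t′) cr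
        ... | _ , eu , ev = trans (sym eu) (proj₁ (proj₂ new-crosses)) , trans (sym ev) (proj₂ (proj₂ new-crosses))

        data MeetOrigin (t p u v : ℤ) : Set where
          at-new : t ≡ t₀ → (u ≡ a × v ≡ b) ⊎ (u ≡ b × v ≡ a) → MeetOrigin t p u v
          outer  : ¬ (t ≡ t′ × p ≡ q′) → Outer t → Meet T t p u v → MeetOrigin t p u v
          inner  : ¬ (t ≡ t′ × p ≡ q′) → t₀ < t → t ≤ t′ →
                   Meet T t p (transpose a b u) (transpose a b v) → MeetOrigin t p u v

        meet-origin : Meet T′ t p u v → MeetOrigin t p u v
        meet-origin {t} {p} m with (t ≟ t₀) ×-dec (p ≟ q)
        ... | yes (refl , refl) = at-new refl (pair m)
          where
            pair : Meet T′ t₀ q u v → (u ≡ a × v ≡ b) ⊎ (u ≡ b × v ≡ a)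
            pair (inj₁ cr) = inj₁ (crosses-at-new cr)
            pair (inj₂ cr) = inj₂ (proj₂ (crosses-at-new cr) , proj₁ (crosses-at-new cr))
        ... | no ≢new with t ≤? t₀ | t ≤? t′
        ...   | yes t≤t₀ | _        = outer ≢removed (inj₁ t≤t₀) (meet-map id (crosses-early t≤t₀ ≢new) m)
          where ≢removed = λ { (refl , refl) → Adds.fresh rem (meet⇒crossing m) }
        ...   | no t≰t₀  | yes t≤t′ =
          inner ≢removed (ZP.≰⇒> t≰t₀) t≤t′ (meet-map (transpose a b) (crosses-inner (ZP.≰⇒> t≰t₀) t≤t′) m)
          where ≢removed = λ { (refl , refl) → Adds.fresh rem (meet⇒crossing m) }
        ...   | no _     | no t≰t′  =
          outer ≢removed (inj₂ (ZP.≰⇒> t≰t′)) (meet-map id (crosses-late (ZP.≰⇒> t≰t′)) m)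
          where ≢removed = λ { (refl , refl) → Adds.fresh rem (meet⇒crossing m) }

        private
          as-ab : (u ≡ a × v ≡ b) ⊎ (u ≡ b × v ≡ a) → Meet T t p u v → Meet T t p a b
          as-ab (inj₁ (refl , refl)) m = m
          as-ab (inj₂ (refl , refl)) m = meet-sym m

          as-ab-transposed : (u ≡ a × v ≡ b) ⊎ (u ≡ b × v ≡ a) →
                             Meet T t p (transpose a b u) (transpose a b v) → Meet T t p a b
          as-ab-transposed (inj₁ (refl , refl)) m =
            meet-sym (subst₂ (Meet T _ _) (transpose-first a b) (transpose-second a≢b) m)
          as-ab-transposed (inj₂ (refl , refl)) m =
            subst₂ (Meet T _ _) (transpose-second a≢b) (transpose-first a b) m

        once′ : MeetOnce T′
        once′ m₁ m₂ with meet-origin m₁ | meet-origin m₂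
        ... | at-new e₁ _           | at-new e₂ _           = trans e₁ (sym e₂)
        ... | at-new _ ab    | outer ≢removed _ m   = contradiction (meet-ab-only-at-t′ (as-ab ab m)) ≢removed
        ... | at-new _ ab    | inner ≢removed _ _ m =
          contradiction (meet-ab-only-at-t′ (as-ab-transposed ab m)) ≢removed
        ... | outer ≢removed _ m   | at-new _ ab    = contradiction (meet-ab-only-at-t′ (as-ab ab m)) ≢removed
        ... | inner ≢removed _ _ m | at-new _ ab    =
          contradiction (meet-ab-only-at-t′ (as-ab-transposed ab m)) ≢removed
        ... | outer _ _ m    | outer _ _ m″         = once m m″
        ... | inner _ _ _ m  | inner _ _ _ m″       = once m m″
        ... | outer _ o m    | inner ≢removed t₀<t t≤t′ m″ = outer-inner-meets o m t₀<t t≤t′ ≢removed m″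
        ... | inner ≢removed t₀<t t≤t′ m | outer _ o m″    = sym (outer-inner-meets o m″ t₀<t t≤t′ ≢removed m)

        apart′ : NonposApart T′
        apart′ cr u≤0 v≤0 with meet-origin (inj₁ cr)
        ... | at-new _ (inj₁ (u≡a , _)) = nonpos≢a u≤0 u≡a
        ... | at-new _ (inj₂ (_ , v≡a)) = nonpos≢a v≤0 v≡a
        ... | outer _ _ m              = nonpos-never-meet u≤0 v≤0 m
        ... | inner _ t₀<t t≤t′ m with late-nonpos-meet⇒meet-ab t₀<t m u≤0 v≤0
        ...   | s , _ , s<t , _ , m-ab = ZP.<-irrefl (proj₁ (meet-ab-only-at-t′ m-ab)) (ZP.<-≤-trans s<t t≤t′)

adds-cons : ∀ {c T} → c ∉ T → Adds T (c ∷ T) (time c) (pos c)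
adds-cons c∉T = record
  { kept  = there
  ; added = λ { (here (at e₁ e₂)) → inj₂ (sym e₁ , sym e₂) ; (there x) → inj₁ x }
  ; new   = here (at refl refl)
  ; fresh = ∉⇒¬crossing c∉T (at refl refl)
  }

adds-remove : ∀ {c S} → c ∈ S → Adds (remove c S) S (time c) (pos c)
adds-remove {c} {S} c∈S = record
  { kept  = λ x → let _ , d∈ , d-at = find x in lose (proj₁ (∈-filter⁻ ≢c? d∈)) d-at
  ; added = added
  ; new   = lose c∈S (at refl refl)
  ; fresh = λ x → let _ , d∈ , d-at = find x in proj₂ (∈-filter⁻ ≢c? {xs = S} d∈) (at-unique d-at (at refl refl))
  }
  where
    ≢c? = λ d → ¬? (d ≟C c)
    added : ∀ {t p} → Crossing S t p → Crossing (remove c S) t p ⊎ (t ≡ time c × p ≡ pos c)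
    added x with find x
    ... | d , d∈S , d-at with d ≟C c
    ...   | yes refl = inj₂ (sym (IsAt.time≡ d-at) , sym (IsAt.pos≡ d-at))
    ...   | no d≢c   = inj₁ (lose (∈-filter⁺ ≢c? d∈S d≢c) d-at)

remove-⊆ : ∀ {c d} S → d ∈ remove c S → d ∈ S
remove-⊆ {c} S d∈ = proj₁ (∈-filter⁻ (λ d → ¬? (d ≟C c)) {xs = S} d∈)

module Cells (n : ℕ) (B : ℤ) where
  open Labelling n B
  open Bridge n B
  open Strands n B

  after-cells : ∀ {S} → (∀ {d} → d ∈ S → B ≤ time d) → After S
  after-cells h x with find x
  ... | _ , d∈S , at refl _ = h d∈S

  bounded-cells : ∀ {S} → (∀ {d} → d ∈ S → col d ≤ + n) → Bounded S
  bounded-cells h x with find x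
  ... | (i , k) , d∈S , at refl refl = subst (_≤ + n + + n) (sym (pos-time i k)) (ZP.+-mono-≤ (h d∈S) (h d∈S))

  module _ {S : CellSet} (A : After S) (cols : ∀ {d} → d ∈ S → col d ≤ + n) where
    left-label : d ∈ S → leftLabel n S d ≡ label S (time d) (pos d + 1ℤ)
    left-label {d} d∈S = leftLabel≡leftEdge A (bounded-cells cols) d (cols d∈S)

    bottom-label : d ∈ S → bottomLabel n S d ≡ label S (time d) (pos d)
    bottom-label {d} d∈S = bottomLabel≡bottomEdge A (bounded-cells cols) d (cols d∈S)

    crosses-at-cell : d ∈ S → Crosses S (time d) (pos d) (leftLabel n S d) (bottomLabel n S d)
    crosses-at-cell d∈S = lose d∈S (at refl refl) , sym (left-label d∈S) , sym (bottom-label d∈S)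

    CellLabels : Cell → ℤ → ℤ → Set
    CellLabels d u v = leftLabel n S d ≡ u × bottomLabel n S d ≡ v ⊎ leftLabel n S d ≡ v × bottomLabel n S d ≡ u

    meet-at-cell : Meet S t q u v → ∃ λ d → d ∈ S × IsAt t q d × CellLabels d u v
    meet-at-cell (inj₁ (x , refl , refl)) with find x
    ... | d , d∈S , at refl refl = d , d∈S , at refl refl , inj₁ (left-label d∈S , bottom-label d∈S)
    meet-at-cell (inj₂ (x , refl , refl)) with find x
    ... | d , d∈S , at refl refl = d , d∈S , at refl refl , inj₂ (left-label d∈S , bottom-label d∈S)

    meet-of-same-pair : ∀ {c c′} → c′ ∈ S → SamePair n S c c′ →
                        Meet S (time c′) (pos c′) (leftLabel n S c) (bottomLabel n S c)
    meet-of-same-pair c′∈S (inj₁ (el , eb)) = inj₁ (subst₂ (Crosses S _ _) (sym el) (sym eb) (crosses-at-cell c′∈S))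
    meet-of-same-pair c′∈S (inj₂ (el , eb)) = inj₂ (subst₂ (Crosses S _ _) (sym eb) (sym el) (crosses-at-cell c′∈S))

    meet-once : IsRC n S → MeetOnce S
    meet-once rc m₁ m₂ with meet-at-cell m₁ | meet-at-cell m₂
    ... | d₁ , d₁∈S , at e₁ _ , l₁ | d₂ , d₂∈S , at e₂ _ , l₂ with d₁ ≟C d₂
    ...   | yes refl  = trans (sym e₁) e₂
    ...   | no d₁≢d₂ = contradiction (same-pair l₁ l₂) (rc d₁ d₂ d₁∈S d₂∈S d₁≢d₂)
      where
        same-pair : CellLabels d₁ u v → CellLabels d₂ u v → SamePair n S d₁ d₂
        same-pair (inj₁ (l₁ , b₁)) (inj₁ (l₂ , b₂)) = inj₁ (trans l₁ (sym l₂) , trans b₁ (sym b₂))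
        same-pair (inj₁ (l₁ , b₁)) (inj₂ (l₂ , b₂)) = inj₂ (trans l₁ (sym b₂) , trans b₁ (sym l₂))
        same-pair (inj₂ (l₁ , b₁)) (inj₁ (l₂ , b₂)) = inj₂ (trans l₁ (sym b₂) , trans b₁ (sym l₂))
        same-pair (inj₂ (l₁ , b₁)) (inj₂ (l₂ , b₂)) = inj₁ (trans l₁ (sym l₂) , trans b₁ (sym b₂))

    is-rc : MeetOnce S → IsRC n S
    is-rc once c c′ c∈S c′∈S c≢c′ same = c≢c′ (at-unique (at refl refl) (at (sym t≡) (sym p≡)))
      where
        m : Meet S (time c) (pos c) (leftLabel n S c) (bottomLabel n S c)
        m = inj₁ (crosses-at-cell c∈S)
        m′ : Meet S (time c′) (pos c′) (leftLabel n S c) (bottomLabel n S c)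
        m′ = meet-of-same-pair {c} c′∈S same
        t≡ : time c ≡ time c′
        t≡ = once m m′
        p≡ : pos c ≡ pos c′
        p≡ = meets-sharing-strand A m (subst (λ t → Meet S t (pos c′) _ _) (sym t≡) m′)

    nonpos-apart : NoNonposCross n S → NonposApart S
    nonpos-apart nnc cr u≤0 v≤0 with meet-at-cell (inj₁ cr)
    ... | d , d∈S , _ , inj₁ (eu , ev) = nnc d d∈S (subst (_≤ 0ℤ) (sym eu) u≤0 , subst (_≤ 0ℤ) (sym ev) v≤0)
    ... | d , d∈S , _ , inj₂ (ev , eu) = nnc d d∈S (subst (_≤ 0ℤ) (sym ev) v≤0 , subst (_≤ 0ℤ) (sym eu) u≤0)

    no-nonpos-cross : NonposApart S → NoNonposCross n S
    no-nonpos-cross apart d d∈S (l≤0 , b≤0) = apart (crosses-at-cell d∈S) l≤0 b≤0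

module InsertionStep (n : ℕ) {T : CellSet} {c : Cell} (inT : All (InRange n) T)
                     (rcT : IsRC n T) (nncT : NoNonposCross n T) (open-c : IsOpen n T c) where
  T+c : CellSet
  T+c = c ∷ T

  B : ℤ
  B = foldr (λ d r → time d ⊓ r) (time c) T+c

  open Labelling n B
  open Bridge n B
  open Strands n B
  open Cells n B

  private
    in-range : ∀ {d} → d ∈ T+c → InRange n d
    in-range (here refl) = proj₁ open-c
    in-range (there d∈T) = All.lookup inT d∈T

    after-T+c : After T+c
    after-T+c = after-cells (foldr-⊓-≤-member time (time c) T+c)

    after-T : After T
    after-T = after-cells (foldr-⊓-≤-member time (time c) T+c ∘ there)

    cols-T : ∀ {d} → d ∈ T → col d ≤ + n
    cols-T = proj₁ ∘ in-range ∘ there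

    cols-T+c : ∀ {d} → d ∈ T+c → col d ≤ + n
    cols-T+c = proj₁ ∘ in-range

    a-pos : 0ℤ < label T (time c) (pos c + 1ℤ)
    a-pos = subst (0ℤ <_) (leftLabel≡leftEdge after-T (bounded-cells cols-T) c (cols-T+c (here refl)))
                  (proj₁ (proj₂ (proj₂ open-c)))

    b-nonpos : label T (time c) (pos c) ≤ 0ℤ
    b-nonpos = subst (_≤ 0ℤ) (bottomLabel≡bottomEdge after-T (bounded-cells cols-T) c (cols-T+c (here refl)))
                     (proj₂ (proj₂ (proj₂ open-c)))

    module Step = Insertion.Step n B (adds-cons (proj₁ (proj₂ open-c))) after-T+c after-T
                                    (meet-once after-T cols-T rcT) (nonpos-apart after-T cols-T nncT) a-pos b-nonpos

  stop-preserves : IsRC n T+c → NoNonposCross n T+c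
  stop-preserves rc = no-nonpos-cross after-T+c cols-T+c (Step.stop-case (meet-once after-T+c cols-T+c rc))

  bump-preserves : ∀ {c′} → c′ ∈ T+c → c′ ≢ c → SamePair n T+c c c′ →
         All (InRange n) (remove c′ T+c) × IsRC n (remove c′ T+c) × NoNonposCross n (remove c′ T+c)
  bump-preserves {c′} c′∈T+c c′≢c same =
    All.tabulate (in-range ∘ remove-⊆ T+c) ,
    is-rc after-T′ cols-T′ Removal.once′ ,
    no-nonpos-cross after-T′ cols-T′ Removal.apart′
    where
      m′ : Meet T+c (time c′) (pos c′) Step.a Step.b
      m′ = subst₂ (Meet T+c _ _)
             (trans (left-label after-T+c cols-T+c (here refl)) (proj₁ (proj₂ Step.new-crosses)))
             (trans (bottom-label after-T+c cols-T+c (here refl)) (proj₂ (proj₂ Step.new-crosses)))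
             (meet-of-same-pair after-T+c cols-T+c {c} c′∈T+c same)
      ≢new : ¬ (time c′ ≡ time c × pos c′ ≡ pos c)
      ≢new (e₁ , e₂) = c′≢c (at-unique (at e₁ e₂) (at refl refl))
      after-T′ : After (remove c′ T+c)
      after-T′ = after-cells (foldr-⊓-≤-member time (time c) T+c ∘ remove-⊆ T+c)
      cols-T′ : ∀ {d} → d ∈ remove c′ T+c → col d ≤ + n
      cols-T′ = cols-T+c ∘ remove-⊆ T+c
      module Removal = Step.Bump.Removal m′ ≢new (adds-remove c′∈T+c) after-T′

insertion-preserves : ∀ n {T c R′} → All (InRange n) T → IsRC n T → NoNonposCross n T → IsOpen n T c →
                      Run n (c ∷ T) c R′ → NoNonposCross n R′
insertion-preserves n inT rcT nncT open-c (stop rcS) = InsertionStep.stop-preserves n inT rcT nncT open-c rcS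
insertion-preserves n inT rcT nncT open-c (bump _ c′ c′∈S c′≢c same _ _ least run) =
  insertion-preserves n inT′ rcT′ nncT′ (proj₁ (proj₂ least)) run
  where
    preserved = InsertionStep.bump-preserves n inT rcT nncT open-c c′∈S c′≢c same
    inT′ = proj₁ preserved
    rcT′ = proj₁ (proj₂ preserved)
    nncT′ = proj₂ (proj₂ preserved)

lemma3p1 : (n : ℕ) → + 1 ≤ + n → (R : CellSet) → All (InRange n) R →
    IsRC n R → NoNonposCross n R →
    (k : ℤ) → + 1 ≤ k → k ≤ + n →
    (R' : CellSet) → Insert n R k R' → NoNonposCross n R'
lemma3p1 n _ R inR rcR nncR k _ _ R' (_ , least , run) = insertion-preserves n inR rcR nncR (proj₁ (proj₂ least)) run
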